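{- Let $q$ be a power of an odd prime, let $n\ge 2$ be an even integer, and let $a,c\in\mathbb{F}_q$. Let $f:\mathbb{F}_{q^2}\to\mathbb{F}_{q^2}$ be given by $f(X)=(cX^q+aX)(X^q-X)^{n-1}$. Fix $\beta\in\mathbb{F}_{q^2}\setminus\mathbb{F}_q$ with $\beta^2\in\mathbb{F}_q$, and put $\delta_1=(a-c)(-2)^{n-1}\beta^n$ and $\delta_2=(a+c)(-2)^{n-1}\beta^{n-2}$, and assume $\delta_1\delta_2\neq 0$. Then for every $\alpha\in\mathbb{F}_{q^2}^*$, the number of elements of $f^{ -1}(\alpha)=\{x\in\mathbb{F}_{q^2}: f(x)=\alpha\}$ is either $0$ or $\gcd(n,q-1)$. -}

module Defs where

open import Level using (Level; _⊔_)
open import Algebra.Bundles using (CommutativeRing; Semiring)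
import Algebra.Definitions.RawSemiring as RawSemiringDefs
open import Data.Nat as ℕ using (ℕ; _∸_; _≤_)
open import Data.Nat.Primality using (Prime)
open import Data.Fin using (Fin)
open import Data.List using (length; filter; allFin)
open import Data.Product using (Σ; ∃; _×_)
open import Relation.Nullary using (¬_)
open import Relation.Binary using (Decidable)
open import Relation.Binary.PropositionalEquality using (_≡_; _≢_)

OddPrimePower : ℕ → Set
OddPrimePower q = Σ ℕ λ p → Σ ℕ λ k → Prime p × (p ≢ 2) × (1 ≤ k) × (q ≡ p ℕ.^ k)

module _ {c ℓ : Level} (R : CommutativeRing c ℓ) where
  open CommutativeRing R
  open RawSemiringDefs (Semiring.rawSemiring semiring) using (_^_)

  IsField : Set (c ⊔ ℓ)
  IsField = (¬ (1# ≈ 0#)) × (∀ x → ¬ (x ≈ 0#) → ∃ λ y → (x * y) ≈ 1#)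

  Enumeration : ℕ → Set (c ⊔ ℓ)
  Enumeration N = Σ (Fin N → Carrier) λ e →
    (∀ i j → e i ≈ e j → i ≡ j) × (∀ x → ∃ λ i → e i ≈ x)

  preimageCount : Decidable _≈_ → (N : ℕ) → (Fin N → Carrier) →
                  (Carrier → Carrier) → Carrier → ℕ
  preimageCount _≟_ N e g α = length (filter (λ i → g (e i) ≟ α) (allFin N))

  InSubfield : ℕ → Carrier → Set ℓ
  InSubfield q x = (x ^ q) ≈ x

{-# OPTIONS --safe #-}
module Submission where

-- Write every x ∈ K as u + vβ with u, v ∈ 𝔽_q, which is possible because β^q = -β and 2 ≠ 0.
-- Frobenius gives x^q = u - vβ, hence f(u + vβ) = δ₁vⁿ + δ₂uvⁿ⁻¹β, and comparing coordinates with
-- α = α₁ + α₂β shows that the preimages of α ≠ 0 correspond to the v ∈ 𝔽_q* with vⁿ = α₁/δ₁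
-- (u being forced to α₂/(δ₂vⁿ⁻¹)). In a finite subgroup G of K* such an equation has no solution or
-- exactly d = gcd(n, |G|) of them: a solution v₀ times the d-th roots of unity gives all of them, and
-- there are exactly d such roots since xᵈ - 1 has at most d roots and 1 + xᵈ + x²ᵈ + ⋯ + x^(|G|-d)
-- at most |G| - d. The finite-field facts are derived from the enumeration of K: translations permute K
-- and multiplication by x ≠ 0 permutes K*, which yields characteristic p and x^(q²) = x.

open import Level using (Level; _⊔_)
open import Function using (_∘_; id)
open import Data.Empty using (⊥-elim)
open import Data.Product using (∃; _×_; _,_; proj₁; proj₂)
open import Data.Sum using (_⊎_; inj₁; inj₂; [_,_]′)
open import Data.Maybe using (Maybe; just; nothing)
open import Data.Nat as ℕ using (ℕ; zero; suc; _≤_; _<_; _∸_; _!; z≤n; s≤s)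
import Data.Nat.Properties as ℕ
open import Data.Nat.Divisibility using (_∣_; divides; ∣-refl; ∣1⇒≡1; ∣⇒≤; m∣m*n; ∣m∣n⇒∣m+n; ∣m+n∣m⇒∣n)
open import Data.Nat.DivMod using (m/n*n≡m)
open import Data.Nat.GCD using (gcd; gcd-GCD; gcd[m,n]∣m; gcd[m,n]∣n; module Bézout)
open import Data.Nat.Primality using (Prime; euclidsLemma; prime⇒nonTrivial)
open import Data.Nat.Combinatorics using (_C_; nCn≡1; k![n∸k]!∣n!)
open import Data.Nat.Combinatorics.Specification using (nCk≡n!/k![n-k]!)
open import Data.Integer as ℤ using (ℤ; +_; -[1+_])
import Data.Integer.Properties as ℤ
import Data.Sign as Sign
open import Data.Fin using (Fin; toℕ; fromℕ; inject₁) renaming (zero to fzero; suc to fsuc)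
import Data.Fin.Properties as Fin
open import Data.Vec.Functional using (replicate)
open import Data.List using (List; []; _∷_; _++_; length; lookup; filter; map; foldr; allFin; cartesianProductWith)
import Data.List.Properties as List
open import Data.List.Relation.Unary.Any using (here; there)
open import Data.List.Relation.Unary.All as All using ([]; _∷_)
import Data.List.Relation.Unary.All.Properties as All
open import Data.List.Relation.Unary.AllPairs using ([]; _∷_)
open import Data.List.Membership.Setoid.Properties
  using ( ∈-lookup; index-injective; ∈-∃++; ∈-resp-≈; ∈-map⁺; ∈-map⁻; ∈-filter⁺; ∈-filter⁻; ∈-length
        ; ∈-cartesianProductWith⁺)
import Data.List.Membership.Propositional.Properties as Membershipₚ
open import Data.List.Relation.Unary.Unique.Setoid.Properties using (map⁺; filter⁺)
import Data.List.Relation.Unary.Unique.Propositional.Properties as Uniqueₚ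
open import Relation.Nullary using (¬_; yes; no)
open import Relation.Nullary.Decidable using (toSum)
open import Relation.Unary as Unary using (Pred; _∩_; ∁; U)
open import Relation.Unary.Properties using (∁?)
open import Relation.Binary using (Setoid; Decidable)
open import Relation.Binary.PropositionalEquality as ≡ using (_≡_)
open import Algebra.Bundles using (CommutativeRing; CommutativeMonoid; Semiring)
import Algebra.Definitions.RawSemiring as RawSemiringDefs
import Algebra.Solver.Ring.AlmostCommutativeRing as ACR
open import Defs

module IntegerCoefficientSolver {c ℓ} (R : CommutativeRing c ℓ) where

  open CommutativeRing R
  open import Algebra.Properties.Ring ring using (-‿distribˡ-*; -‿distribʳ-*; -‿+-comm; -‿involutive; -0#≈0#)
  open import Algebra.Properties.CommutativeSemigroup +-commutativeSemigroup using (interchange)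
  open import Algebra.Properties.Semiring.Mult.TCOptimised semiring using (1+×; ×-homo-+; ×1-homo-*) renaming (_×_ to _×′_)
  open import Relation.Binary.Reasoning.Setoid setoid

  -- Integer coefficients keep the solver's normal forms decidable in an arbitrary ring; the
  -- tail-recursive multiple ×′ makes ⟦ + 1 ⟧ℤ reduce to 1#, as `solve … refl` needs.
  ⟦_⟧ℤ : ℤ → Carrier
  ⟦ + n ⟧ℤ      = n ×′ 1#
  ⟦ -[1+ n ] ⟧ℤ = - (suc n ×′ 1#)

  private
    1+x-[1+y]≈x-y : ∀ x y → (1# + x) - (1# + y) ≈ x - y
    1+x-[1+y]≈x-y x y = begin
      (1# + x) - (1# + y)       ≈⟨ +-congˡ (-‿+-comm 1# y) ⟨
      (1# + x) + (- 1# + - y)   ≈⟨ interchange 1# x (- 1#) (- y) ⟩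
      (1# - 1#) + (x - y)       ≈⟨ +-congʳ (-‿inverseʳ 1#) ⟩
      0# + (x - y)              ≈⟨ +-identityˡ _ ⟩
      x - y                     ∎

    ⟦⊖⟧ : ∀ m n → ⟦ m ℤ.⊖ n ⟧ℤ ≈ m ×′ 1# - n ×′ 1#
    ⟦⊖⟧ m       zero    = sym (trans (+-congˡ -0#≈0#) (+-identityʳ _))
    ⟦⊖⟧ zero    (suc n) = sym (+-identityˡ _)
    ⟦⊖⟧ (suc m) (suc n) = begin
      ⟦ suc m ℤ.⊖ suc n ⟧ℤ               ≡⟨ ≡.cong ⟦_⟧ℤ (ℤ.[1+m]⊖[1+n]≡m⊖n m n) ⟩
      ⟦ m ℤ.⊖ n ⟧ℤ                       ≈⟨ ⟦⊖⟧ m n ⟩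
      m ×′ 1# - n ×′ 1#                  ≈⟨ 1+x-[1+y]≈x-y _ _ ⟨
      (1# + m ×′ 1#) - (1# + n ×′ 1#)    ≈⟨ +-cong (1+× m 1#) (-‿cong (1+× n 1#)) ⟨
      suc m ×′ 1# - suc n ×′ 1#          ∎

    ⟦-+⟧ : ∀ n → ⟦ ℤ.- (+ n) ⟧ℤ ≈ - (n ×′ 1#)
    ⟦-+⟧ zero    = sym -0#≈0#
    ⟦-+⟧ (suc n) = refl

    ⟦+⟧ : ∀ i j → ⟦ i ℤ.+ j ⟧ℤ ≈ ⟦ i ⟧ℤ + ⟦ j ⟧ℤ
    ⟦+⟧ (+ m)    (+ n)    = ×-homo-+ 1# m n
    ⟦+⟧ (+ m)    -[1+ n ] = ⟦⊖⟧ m (suc n)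
    ⟦+⟧ -[1+ m ] (+ n)    = trans (⟦⊖⟧ n (suc m)) (+-comm _ _)
    ⟦+⟧ -[1+ m ] -[1+ n ] = begin
      - (suc (suc (m ℕ.+ n)) ×′ 1#)       ≡⟨ ≡.cong (λ k → - (suc k ×′ 1#)) (ℕ.+-suc m n) ⟨
      - ((suc m ℕ.+ suc n) ×′ 1#)         ≈⟨ -‿cong (×-homo-+ 1# (suc m) (suc n)) ⟩
      - (suc m ×′ 1# + suc n ×′ 1#)       ≈⟨ -‿+-comm _ _ ⟨
      - (suc m ×′ 1#) + - (suc n ×′ 1#)   ∎

    ⟦*⟧ : ∀ i j → ⟦ i ℤ.* j ⟧ℤ ≈ ⟦ i ⟧ℤ * ⟦ j ⟧ℤ
    ⟦*⟧ (+ m)    (+ n)    = begin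
      ⟦ Sign.+ ℤ.◃ (m ℕ.* n) ⟧ℤ           ≡⟨ ≡.cong ⟦_⟧ℤ (ℤ.+◃n≡+n (m ℕ.* n)) ⟩
      (m ℕ.* n) ×′ 1#                     ≈⟨ ×1-homo-* m n ⟩
      (m ×′ 1#) * (n ×′ 1#)               ∎
    ⟦*⟧ (+ m)    -[1+ n ] = begin
      ⟦ Sign.- ℤ.◃ (m ℕ.* suc n) ⟧ℤ       ≡⟨ ≡.cong ⟦_⟧ℤ (ℤ.-◃n≡-n (m ℕ.* suc n)) ⟩
      ⟦ ℤ.- (+ (m ℕ.* suc n)) ⟧ℤ          ≈⟨ ⟦-+⟧ (m ℕ.* suc n) ⟩
      - ((m ℕ.* suc n) ×′ 1#)             ≈⟨ -‿cong (×1-homo-* m (suc n)) ⟩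
      - ((m ×′ 1#) * (suc n ×′ 1#))       ≈⟨ -‿distribʳ-* _ _ ⟩
      (m ×′ 1#) * - (suc n ×′ 1#)         ∎
    ⟦*⟧ -[1+ m ] (+ n)    = begin
      ⟦ Sign.- ℤ.◃ (suc m ℕ.* n) ⟧ℤ       ≡⟨ ≡.cong ⟦_⟧ℤ (ℤ.-◃n≡-n (suc m ℕ.* n)) ⟩
      ⟦ ℤ.- (+ (suc m ℕ.* n)) ⟧ℤ          ≈⟨ ⟦-+⟧ (suc m ℕ.* n) ⟩
      - ((suc m ℕ.* n) ×′ 1#)             ≈⟨ -‿cong (×1-homo-* (suc m) n) ⟩
      - ((suc m ×′ 1#) * (n ×′ 1#))       ≈⟨ -‿distribˡ-* _ _ ⟩
      - (suc m ×′ 1#) * (n ×′ 1#)         ∎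
    ⟦*⟧ -[1+ m ] -[1+ n ] = begin
      (suc m ℕ.* suc n) ×′ 1#             ≈⟨ ×1-homo-* (suc m) (suc n) ⟩
      (suc m ×′ 1#) * (suc n ×′ 1#)       ≈⟨ -‿involutive _ ⟨
      - - ((suc m ×′ 1#) * (suc n ×′ 1#)) ≈⟨ -‿cong (-‿distribˡ-* _ _) ⟩
      - (- (suc m ×′ 1#) * (suc n ×′ 1#)) ≈⟨ -‿distribʳ-* _ _ ⟩
      - (suc m ×′ 1#) * - (suc n ×′ 1#)   ∎

    ⟦-⟧ : ∀ i → ⟦ ℤ.- i ⟧ℤ ≈ - ⟦ i ⟧ℤ
    ⟦-⟧ (+ n)    = ⟦-+⟧ n
    ⟦-⟧ -[1+ n ] = sym (-‿involutive _)

  ⟦⟧ℤ-homomorphism : CommutativeRing.rawRing ℤ.+-*-commutativeRing ACR.-Raw-AlmostCommutative⟶ ACR.fromCommutativeRing R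
  ⟦⟧ℤ-homomorphism = record
    { ⟦_⟧    = ⟦_⟧ℤ
    ; +-homo = ⟦+⟧
    ; *-homo = ⟦*⟧
    ; -‿homo = ⟦-⟧
    ; 0-homo = refl
    ; 1-homo = refl
    }

  private
    _≟ℤ_ : ∀ i j → Maybe (⟦ i ⟧ℤ ≈ ⟦ j ⟧ℤ)
    i ≟ℤ j with i ℤ.≟ j
    ... | yes ≡.refl = just refl
    ... | no _       = nothing

  open import Algebra.Solver.Ring
    (CommutativeRing.rawRing ℤ.+-*-commutativeRing) (ACR.fromCommutativeRing R) ⟦⟧ℤ-homomorphism _≟ℤ_ public


length-cartesianProductWith : ∀ {a b c} {A : Set a} {B : Set b} {C : Set c} (f : A → B → C) xs ys →
                              length (cartesianProductWith f xs ys) ≡ length xs ℕ.* length ys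
length-cartesianProductWith f []       ys = ≡.refl
length-cartesianProductWith f (x ∷ xs) ys = ≡.trans (List.length-++ (map (f x) ys))
  (≡.cong₂ ℕ._+_ (List.length-map (f x) ys) (length-cartesianProductWith f xs ys))

module UniqueLists {a ℓ} (S : Setoid a ℓ) where

  open Setoid S renaming (Carrier to A)
  open import Data.List.Membership.Setoid S using (_∈_) public
  open import Data.List.Relation.Unary.Unique.Setoid S using (Unique; head; tail) public
  open import Data.List.Relation.Binary.Permutation.Setoid S using (_↭_; ↭-refl; ↭-trans; ↭-sym; prep)
  open import Data.List.Relation.Binary.Permutation.Setoid.Properties S
    using (∈-resp-↭; Unique-resp-↭; ↭-shift; ≋⇒↭; xs↭ys⇒|xs|≡|ys|)

  ≉-head : ∀ {x z xs} → Unique (x ∷ xs) → z ∈ xs → ¬ z ≈ x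
  ≉-head u z∈xs z≈x = All.lookupₛ S (λ y≈z x≉y x≈z → x≉y (trans x≈z (sym y≈z))) (head u) z∈xs (sym z≈x)

  ∈-tail : ∀ {x z xs} → z ∈ x ∷ xs → ¬ z ≈ x → z ∈ xs
  ∈-tail (here z≈x)   z≉x = ⊥-elim (z≉x z≈x)
  ∈-tail (there z∈xs) _   = z∈xs

  lookup-injective : ∀ {xs} → Unique xs → ∀ i j → lookup xs i ≈ lookup xs j → i ≡ j
  lookup-injective {_ ∷ _}  _       fzero    fzero    _  = ≡.refl
  lookup-injective {_ ∷ xs} u       fzero    (fsuc j) eq = ⊥-elim (≉-head u (∈-lookup S xs j) (sym eq))
  lookup-injective {_ ∷ xs} u       (fsuc i) fzero    eq = ⊥-elim (≉-head u (∈-lookup S xs i) eq)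
  lookup-injective {_ ∷ _}  (_ ∷ u) (fsuc i) (fsuc j) eq = ≡.cong fsuc (lookup-injective u i j eq)

  length-mono-⊆ : ∀ {xs ys} → Unique xs → (∀ {z} → z ∈ xs → z ∈ ys) → length xs ≤ length ys
  length-mono-⊆ {xs} u xs⊆ys = Fin.injective⇒≤ λ {i} {j} eq →
    lookup-injective u i j (index-injective S (xs⊆ys (∈-lookup S xs i)) (xs⊆ys (∈-lookup S xs j)) eq)

  Unique-sameMembers⇒↭ : ∀ {xs ys} → Unique xs → Unique ys →
    (∀ {z} → z ∈ xs → z ∈ ys) → (∀ {z} → z ∈ ys → z ∈ xs) → xs ↭ ys
  Unique-sameMembers⇒↭ {[]}     {[]}    _ _ _ _ = ↭-refl
  Unique-sameMembers⇒↭ {[]}     {_ ∷ _} _ _ _ ys⊆[] with ys⊆[] (here refl)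
  ... | ()
  Unique-sameMembers⇒↭ {x ∷ xs} {ys} u@(_ ∷ uxs) uys xs⊆ys ys⊆xs
    with as , bs , w , x≈w , ys≋ ← ∈-∃++ S (xs⊆ys (here refl)) = ↭-trans (prep x≈w xs↭as++bs) (↭-sym ys↭)
    where
    ys↭ : ys ↭ w ∷ as ++ bs
    ys↭ = ↭-trans (≋⇒↭ ys≋) (↭-shift as bs)
    uw : Unique (w ∷ as ++ bs)
    uw = Unique-resp-↭ ys↭ uys
    xs↭as++bs : xs ↭ as ++ bs
    xs↭as++bs = Unique-sameMembers⇒↭ uxs (tail uw)
      (λ z∈xs → ∈-tail (∈-resp-↭ ys↭ (xs⊆ys (there z∈xs))) (λ z≈w → ≉-head u z∈xs (trans z≈w (sym x≈w))))
      (λ z∈ → ∈-tail (ys⊆xs (∈-resp-↭ (↭-sym ys↭) (there z∈))) (λ z≈x → ≉-head uw z∈ (trans z≈x x≈w)))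

  Unique-map⁺-on : ∀ {f : A → A} {xs} → (∀ {x y} → x ∈ xs → y ∈ xs → f x ≈ f y → x ≈ y) →
                   Unique xs → Unique (map f xs)
  Unique-map⁺-on {xs = []}     _   _ = []
  Unique-map⁺-on {xs = x ∷ xs} inj u =
    All.map⁺ (All.tabulateₛ S λ y∈xs fx≈fy → ≉-head u y∈xs (sym (inj (here refl) (there y∈xs) fx≈fy)))
    ∷ Unique-map⁺-on (λ x∈ y∈ → inj (there x∈) (there y∈)) (tail u)

  record Listing {p} (P : Pred A p) (xs : List A) : Set (a ⊔ ℓ ⊔ p) where
    field
      unique   : Unique xs
      sound    : ∀ {z} → z ∈ xs → P z
      complete : ∀ {z} → P z → z ∈ xs

    resp : ∀ {y z} → y ≈ z → P y → P z
    resp y≈z Py = sound (∈-resp-≈ S y≈z (complete Py))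

  module _ {p} {P : Pred A p} where

    Listing⇒↭ : ∀ {xs ys} → Listing P xs → Listing P ys → xs ↭ ys
    Listing⇒↭ Lxs Lys = Unique-sameMembers⇒↭ (Listing.unique Lxs) (Listing.unique Lys)
      (Listing.complete Lys ∘ Listing.sound Lxs) (Listing.complete Lxs ∘ Listing.sound Lys)

    Listing-length : ∀ {xs ys} → Listing P xs → Listing P ys → length xs ≡ length ys
    Listing-length Lxs Lys = xs↭ys⇒|xs|≡|ys| (Listing⇒↭ Lxs Lys)

    Listing-filter : ∀ {q} {Q : Pred A q} (Q? : Unary.Decidable Q) → (∀ {y z} → y ≈ z → Q y → Q z) →
                     ∀ {xs} → Listing P xs → Listing (P ∩ Q) (filter Q? xs)
    Listing-filter Q? Q-resp Lxs = record
      { unique   = filter⁺ S Q? (Listing.unique Lxs)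
      ; sound    = λ z∈ → let z∈xs , Qz = ∈-filter⁻ S Q? Q-resp z∈ in Listing.sound Lxs z∈xs , Qz
      ; complete = λ (Pz , Qz) → ∈-filter⁺ S Q? Q-resp (Listing.complete Lxs Pz) Qz
      }

    Listing-map : ∀ {q} {Q : Pred A q} {f : A → A} → (∀ {x y} → x ≈ y → f x ≈ f y) →
                  (∀ {x y} → P x → P y → f x ≈ f y → x ≈ y) → (∀ {x} → P x → Q (f x)) →
                  (∀ {z} → Q z → ∃ λ x → P x × z ≈ f x) → (∀ {y z} → y ≈ z → Q y → Q z) →
                  ∀ {xs} → Listing P xs → Listing Q (map f xs)
    Listing-map f-cong inj PQ onto Q-resp Lxs = record
      { unique   = Unique-map⁺-on (λ x∈ y∈ → inj (Listing.sound Lxs x∈) (Listing.sound Lxs y∈)) (Listing.unique Lxs)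
      ; sound    = λ z∈ → let x , x∈xs , z≈fx = ∈-map⁻ S S z∈ in Q-resp (sym z≈fx) (PQ (Listing.sound Lxs x∈xs))
      ; complete = λ Qz → let x , Px , z≈fx = onto Qz in
                   ∈-resp-≈ S (sym z≈fx) (∈-map⁺ S S f-cong (Listing.complete Lxs Px))
      }

  length-filter+length-filter-∁ : ∀ {p} {P : Pred A p} (P? : Unary.Decidable P) xs →
    length (filter P? xs) ℕ.+ length (filter (∁? P?) xs) ≡ length xs
  length-filter+length-filter-∁ P? []       = ≡.refl
  length-filter+length-filter-∁ P? (x ∷ xs) with P? x
  ... | yes _ = ≡.cong suc (length-filter+length-filter-∁ P? xs)
  ... | no  _ = ≡.trans (ℕ.+-suc _ _) (≡.cong suc (length-filter+length-filter-∁ P? xs))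


module CommutativeMonoidFold {a ℓ} (M : CommutativeMonoid a ℓ) where

  open CommutativeMonoid M renaming (Carrier to A)
  open import Algebra.Definitions.RawMonoid rawMonoid using () renaming (_×_ to _·_)
  open import Data.Product using (_×_)
  open import Algebra.Properties.CommutativeSemigroup commutativeSemigroup using (interchange)
  open import Data.List.Relation.Binary.Permutation.Setoid.Properties setoid using (foldr-commMonoid)
  open import Relation.Binary.Reasoning.Setoid setoid
  open UniqueLists setoid

  fold : List A → A
  fold = foldr _∙_ ε

  fold-map-∙ : ∀ x xs → fold (map (x ∙_) xs) ≈ (length xs · x) ∙ fold xs
  fold-map-∙ x []       = sym (identityˡ ε)
  fold-map-∙ x (y ∷ ys) = begin
    (x ∙ y) ∙ fold (map (x ∙_) ys)      ≈⟨ ∙-congˡ (fold-map-∙ x ys) ⟩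
    (x ∙ y) ∙ ((length ys · x) ∙ fold ys) ≈⟨ interchange x y (length ys · x) (fold ys) ⟩
    (x ∙ (length ys · x)) ∙ (y ∙ fold ys) ∎

  length·x∙fold≈fold : ∀ {p} {P : Pred A p} {x xs} → Listing P xs →
    (∀ {y z} → x ∙ y ≈ x ∙ z → y ≈ z) → (∀ {z} → P z → P (x ∙ z)) →
    (∀ {z} → P z → ∃ λ y → P y × z ≈ x ∙ y) →
    (length xs · x) ∙ fold xs ≈ fold xs
  length·x∙fold≈fold {P = P} {x} {xs} Lxs cancel closed onto = begin
    (length xs · x) ∙ fold xs  ≈⟨ fold-map-∙ x xs ⟨
    fold (map (x ∙_) xs)       ≈⟨ foldr-commMonoid isCommutativeMonoid (Listing⇒↭ Lxxs Lxs) ⟩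
    fold xs                    ∎
    where
    Lxxs : Listing P (map (x ∙_) xs)
    Lxxs = Listing-map ∙-congˡ (λ _ _ → cancel) closed onto (Listing.resp Lxs) Lxs


module PrimeBinomial where


  prime∤! : ∀ {p} → Prime p → ∀ m → m < p → ¬ p ∣ m !
  prime∤! pr zero    _   p∣1   = ℕ.<⇒≢ (ℕ.nonTrivial⇒n>1 _ {{prime⇒nonTrivial pr}}) (≡.sym (∣1⇒≡1 p∣1))
  prime∤! pr (suc m) m<p p∣m+1! with euclidsLemma (suc m) (m !) pr p∣m+1!
  ... | inj₁ p∣m+1 = ℕ.<⇒≱ m<p (∣⇒≤ p∣m+1)
  ... | inj₂ p∣m!  = prime∤! pr m (ℕ.<-trans (ℕ.n<1+n m) m<p) p∣m!

  C*!*!≡! : ∀ n k → k ≤ n → (n C k) ℕ.* (k ! ℕ.* (n ∸ k) !) ≡ n !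
  C*!*!≡! n k k≤n = ≡.trans (≡.cong (ℕ._* (k ! ℕ.* (n ∸ k) !)) (nCk≡n!/k![n-k]! k≤n))
    (m/n*n≡m {{k ℕ.!* (n ∸ k) !≢0}} (k![n∸k]!∣n! k≤n))

  prime∣C : ∀ {p} → Prime p → ∀ j → 0 < j → j < p → p ∣ p C j
  prime∣C {zero}         _  _ _   ()
  prime∣C {p@(suc p′)} pr j 0<j j<p with euclidsLemma (p C j) (j ! ℕ.* (p ∸ j) !) pr p∣C*!*!
    where
    p∣C*!*! : p ∣ (p C j) ℕ.* (j ! ℕ.* (p ∸ j) !)
    p∣C*!*! = ≡.subst (p ∣_) (≡.sym (C*!*!≡! p j (ℕ.<⇒≤ j<p))) (m∣m*n (p′ !))
  ... | inj₁ p∣C = p∣C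
  ... | inj₂ p∣!* with euclidsLemma (j !) ((p ∸ j) !) pr p∣!*
  ...   | inj₁ p∣j!   = ⊥-elim (prime∤! pr j j<p p∣j!)
  ...   | inj₂ p∣p-j! = ⊥-elim (prime∤! pr (p ∸ j) (ℕ.∸-monoʳ-< 0<j (ℕ.<⇒≤ j<p)) p∣p-j!)


module Frobenius {c ℓ} (R : CommutativeRing c ℓ) where

  open CommutativeRing R
  open import Algebra.Properties.Semiring.Exp semiring using (_^_; ^-congˡ; ^-congʳ; ^-assocʳ)
  open import Algebra.Properties.Semiring.Mult semiring using (×-homo-1; ×-assoc-*; ×-congʳ; ×-assocˡ) renaming (_×_ to _·_)
  open import Algebra.Properties.Semiring.Sum semiring using (sum; sum-init-last; sum-cong-≋; sum-replicate; sum-replicate-zero)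
  import Algebra.Properties.CommutativeSemiring.Binomial commutativeSemiring as Binomial
  open import Relation.Binary.Reasoning.Setoid setoid

  ^-distrib-+-if-binomials-vanish : ∀ {m} → 0 < m → (∀ j → 0 < j → j < m → ∀ z → (m C j) · z ≈ 0#) →
                                     ∀ x y → (x + y) ^ m ≈ x ^ m + y ^ m
  ^-distrib-+-if-binomials-vanish {suc n} _ C×≈0 x y = begin
    (x + y) ^ suc n                                                  ≈⟨ Binomial.theorem (suc n) x y ⟩
    t fzero + sum (λ i → t (fsuc i))                                  ≈⟨ +-congˡ (sum-init-last (λ i → t (fsuc i))) ⟩
    t fzero + (sum (λ i → t (fsuc (inject₁ i))) + t (fromℕ (suc n)))  ≈⟨ +-congˡ (+-congʳ middle≈0) ⟩
    t fzero + (0# + t (fromℕ (suc n)))                                ≈⟨ +-cong first (trans (+-identityˡ _) last) ⟩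
    y ^ suc n + x ^ suc n                                             ≈⟨ +-comm _ _ ⟩
    x ^ suc n + y ^ suc n                                             ∎
    where
    t : Fin (suc (suc n)) → Carrier
    t = Binomial.binomialTerm x y (suc n)
    first : t fzero ≈ y ^ suc n
    first = trans (×-homo-1 _) (*-identityˡ _)
    last : t (fromℕ (suc n)) ≈ x ^ suc n
    last = term-at (fromℕ (suc n)) (Fin.toℕ-fromℕ (suc n))
      where
      term-at : ∀ i → toℕ i ≡ suc n → t i ≈ x ^ suc n
      term-at i i≡n+1 rewrite i≡n+1 = begin
        (suc n C suc n) · (x ^ suc n * y ^ (n ∸ n)) ≡⟨ ≡.cong (_· (x ^ suc n * y ^ (n ∸ n))) (nCn≡1 (suc n)) ⟩
        1 · (x ^ suc n * y ^ (n ∸ n))               ≈⟨ ×-homo-1 _ ⟩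
        x ^ suc n * y ^ (n ∸ n)                     ≈⟨ *-congˡ (^-congʳ y (ℕ.n∸n≡0 n)) ⟩
        x ^ suc n * 1#                              ≈⟨ *-identityʳ _ ⟩
        x ^ suc n                                   ∎
    middle≈0 : sum (λ i → t (fsuc (inject₁ i))) ≈ 0#
    middle≈0 = trans (sum-cong-≋ (λ i → C×≈0 (suc (toℕ (inject₁ i))) (s≤s z≤n)
                 (s≤s (≡.subst (_< n) (≡.sym (Fin.toℕ-inject₁ i)) (Fin.toℕ<n i))) _))
               (sum-replicate-zero n)

  module _ {p} (p-prime : Prime p) (char-p : p · 1# ≈ 0#) where

    ∣⇒×≈0 : ∀ {m} z → p ∣ m → m · z ≈ 0#
    ∣⇒×≈0 z (divides k ≡.refl) = begin
      (k ℕ.* p) · z     ≈⟨ ×-assocˡ z k p ⟨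
      k · (p · z)       ≈⟨ ×-congʳ k p×z≈0 ⟩
      k · 0#            ≈⟨ sum-replicate k ⟨
      sum (replicate k 0#) ≈⟨ sum-replicate-zero k ⟩
      0#                ∎
      where
      p×z≈0 : p · z ≈ 0#
      p×z≈0 = begin
        p · z          ≈⟨ ×-congʳ p (*-identityˡ z) ⟨
        p · (1# * z)   ≈⟨ ×-assoc-* p 1# z ⟨
        (p · 1#) * z   ≈⟨ *-congʳ char-p ⟩
        0# * z         ≈⟨ zeroˡ z ⟩
        0#             ∎

    frobenius : ∀ x y → (x + y) ^ p ≈ x ^ p + y ^ p
    frobenius = ^-distrib-+-if-binomials-vanish (ℕ.<-trans (s≤s z≤n) (ℕ.nonTrivial⇒n>1 p {{prime⇒nonTrivial p-prime}}))
       (λ j 0<j j<p z → ∣⇒×≈0 z (PrimeBinomial.prime∣C p-prime j 0<j j<p))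

    frobenius-^ : ∀ j x y → (x + y) ^ (p ℕ.^ j) ≈ x ^ (p ℕ.^ j) + y ^ (p ℕ.^ j)
    frobenius-^ zero    x y = trans (*-identityʳ _) (+-cong (sym (*-identityʳ x)) (sym (*-identityʳ y)))
    frobenius-^ (suc j) x y = begin
      (x + y) ^ (p ℕ.* p ℕ.^ j)                ≈⟨ ^-assocʳ _ p (p ℕ.^ j) ⟨
      ((x + y) ^ p) ^ (p ℕ.^ j)                ≈⟨ ^-congˡ (p ℕ.^ j) (frobenius x y) ⟩
      (x ^ p + y ^ p) ^ (p ℕ.^ j)              ≈⟨ frobenius-^ j _ _ ⟩
      (x ^ p) ^ (p ℕ.^ j) + (y ^ p) ^ (p ℕ.^ j) ≈⟨ +-cong (^-assocʳ x p _) (^-assocʳ y p _) ⟩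
      x ^ (p ℕ.* p ℕ.^ j) + y ^ (p ℕ.* p ℕ.^ j) ∎


module DecidableField {c ℓ} (K : CommutativeRing c ℓ) (isField : IsField K)
                      (_≟_ : Decidable (CommutativeRing._≈_ K)) where

  open CommutativeRing K
  open UniqueLists setoid
  open import Data.Product using (_×_)
  open import Algebra.Properties.Ring ring using (-1*x≈-x; x∙y⁻¹≈ε⇒x≈y; +-cancelˡ; +-identityˡ-unique)
  open import Algebra.Properties.Semiring.Exp semiring using (_^_; ^-congˡ; ^-congʳ; ^-assocʳ; ^-homo-*)
  open import Algebra.Properties.CommutativeSemiring.Exp commutativeSemiring using (^-distrib-*)
  open import Relation.Binary.Reasoning.Setoid setoid
  open IntegerCoefficientSolver K using (solve; _:=_; _:+_; _:*_; _:-_; :-_; con)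

  1≉0 : 1# ≉ 0#
  1≉0 = proj₁ isField

  -- Division by zero is junk: 0# ⁻¹ = 0#.
  infix 9 _⁻¹
  _⁻¹ : Carrier → Carrier
  x ⁻¹ with x ≟ 0#
  ... | yes _   = 0#
  ... | no  x≉0 = proj₁ (proj₂ isField x x≉0)

  x*x⁻¹≈1 : ∀ {x} → x ≉ 0# → x * x ⁻¹ ≈ 1#
  x*x⁻¹≈1 {x} x≉0 with x ≟ 0#
  ... | yes x≈0 = ⊥-elim (x≉0 x≈0)
  ... | no  x≉0 = proj₂ (proj₂ isField x x≉0)

  x⁻¹*x≈1 : ∀ {x} → x ≉ 0# → x ⁻¹ * x ≈ 1#
  x⁻¹*x≈1 x≉0 = trans (*-comm _ _) (x*x⁻¹≈1 x≉0)

  0⁻¹≈0 : ∀ {x} → x ≈ 0# → x ⁻¹ ≈ 0#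
  0⁻¹≈0 {x} x≈0 with x ≟ 0#
  ... | yes _   = refl
  ... | no  x≉0 = ⊥-elim (x≉0 x≈0)

  y≈x⁻¹*[x*y] : ∀ {x} y → x ≉ 0# → y ≈ x ⁻¹ * (x * y)
  y≈x⁻¹*[x*y] {x} y x≉0 = begin
    y                 ≈⟨ *-identityˡ y ⟨
    1# * y            ≈⟨ *-congʳ (x⁻¹*x≈1 x≉0) ⟨
    (x ⁻¹ * x) * y    ≈⟨ *-assoc _ _ _ ⟩
    x ⁻¹ * (x * y)    ∎

  x*[x⁻¹*y]≈y : ∀ {x} y → x ≉ 0# → x * (x ⁻¹ * y) ≈ y
  x*[x⁻¹*y]≈y {x} y x≉0 = begin
    x * (x ⁻¹ * y)    ≈⟨ *-assoc _ _ _ ⟨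
    (x * x ⁻¹) * y    ≈⟨ *-congʳ (x*x⁻¹≈1 x≉0) ⟩
    1# * y            ≈⟨ *-identityˡ y ⟩
    y                 ∎

  *-cancelˡ : ∀ {x y z} → x ≉ 0# → x * y ≈ x * z → y ≈ z
  *-cancelˡ {x} {y} {z} x≉0 xy≈xz = begin
    y                ≈⟨ y≈x⁻¹*[x*y] y x≉0 ⟩
    x ⁻¹ * (x * y)   ≈⟨ *-congˡ xy≈xz ⟩
    x ⁻¹ * (x * z)   ≈⟨ y≈x⁻¹*[x*y] z x≉0 ⟨
    z                ∎

  *-cancelʳ : ∀ {x y z} → x ≉ 0# → y * x ≈ z * x → y ≈ z
  *-cancelʳ x≉0 yx≈zx = *-cancelˡ x≉0 (trans (*-comm _ _) (trans yx≈zx (*-comm _ _)))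

  x*y≈0⇒x≈0⊎y≈0 : ∀ {x y} → x * y ≈ 0# → x ≈ 0# ⊎ y ≈ 0#
  x*y≈0⇒x≈0⊎y≈0 {x} {y} xy≈0 with x ≟ 0#
  ... | yes x≈0 = inj₁ x≈0
  ... | no  x≉0 = inj₂ (*-cancelˡ x≉0 (trans xy≈0 (sym (zeroʳ x))))

  x≉0∧y≉0⇒x*y≉0 : ∀ {x y} → x ≉ 0# → y ≉ 0# → x * y ≉ 0#
  x≉0∧y≉0⇒x*y≉0 x≉0 y≉0 xy≈0 = [ x≉0 , y≉0 ]′ (x*y≈0⇒x≈0⊎y≈0 xy≈0)

  x-y≈0⇒x≈y : ∀ {x y} → x - y ≈ 0# → x ≈ y
  x-y≈0⇒x≈y = x∙y⁻¹≈ε⇒x≈y _ _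

  x^n≉0 : ∀ {x} n → x ≉ 0# → x ^ n ≉ 0#
  x^n≉0 zero    _   = 1≉0
  x^n≉0 (suc n) x≉0 = x≉0∧y≉0⇒x*y≉0 x≉0 (x^n≉0 n x≉0)

  x^n≈0⇒x≈0 : ∀ {x} n → x ^ n ≈ 0# → x ≈ 0#
  x^n≈0⇒x≈0 {x} n xⁿ≈0 with x ≟ 0#
  ... | yes x≈0 = x≈0
  ... | no  x≉0 = ⊥-elim (x^n≉0 n x≉0 xⁿ≈0)

  0^n≈0 : ∀ {n} → 0 < n → 0# ^ n ≈ 0#
  0^n≈0 {suc n} _ = zeroˡ _

  1^n≈1 : ∀ n → 1# ^ n ≈ 1#
  1^n≈1 zero    = refl
  1^n≈1 (suc n) = trans (*-identityˡ _) (1^n≈1 n)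

  x^m≈1⇒x^[k*m]≈1 : ∀ {x} k m → x ^ m ≈ 1# → x ^ (k ℕ.* m) ≈ 1#
  x^m≈1⇒x^[k*m]≈1 {x} k m xᵐ≈1 = begin
    x ^ (k ℕ.* m)   ≡⟨ ≡.cong (x ^_) (ℕ.*-comm k m) ⟩
    x ^ (m ℕ.* k)   ≈⟨ ^-assocʳ x m k ⟨
    (x ^ m) ^ k     ≈⟨ ^-congˡ k xᵐ≈1 ⟩
    1# ^ k          ≈⟨ 1^n≈1 k ⟩
    1#              ∎

  x^m≈1⇒x^n≈1 : ∀ {x m n} → m ∣ n → x ^ m ≈ 1# → x ^ n ≈ 1#
  x^m≈1⇒x^n≈1 {m = m} (divides k ≡.refl) = x^m≈1⇒x^[k*m]≈1 k m

  x^k≈1∧x^l≈1⇒x^[a*k-b*l]≈1 : ∀ {x k l} d a b → x ^ k ≈ 1# → x ^ l ≈ 1# →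
                              d ℕ.+ b ℕ.* l ≡ a ℕ.* k → x ^ d ≈ 1#
  x^k≈1∧x^l≈1⇒x^[a*k-b*l]≈1 {x} {k} {l} d a b xᵏ≈1 xˡ≈1 d+b*l≡a*k = begin
    x ^ d                     ≈⟨ *-identityʳ _ ⟨
    x ^ d * 1#                ≈⟨ *-congˡ (x^m≈1⇒x^[k*m]≈1 b l xˡ≈1) ⟨
    x ^ d * x ^ (b ℕ.* l)     ≈⟨ ^-homo-* x d (b ℕ.* l) ⟨
    x ^ (d ℕ.+ b ℕ.* l)       ≡⟨ ≡.cong (x ^_) d+b*l≡a*k ⟩
    x ^ (a ℕ.* k)             ≈⟨ x^m≈1⇒x^[k*m]≈1 a k xᵏ≈1 ⟩
    1#                        ∎

  x^m≈1∧x^n≈1⇒x^gcd≈1 : ∀ {x} m n → x ^ m ≈ 1# → x ^ n ≈ 1# → x ^ gcd m n ≈ 1#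
  x^m≈1∧x^n≈1⇒x^gcd≈1 m n xᵐ≈1 xⁿ≈1 with Bézout.identity (gcd-GCD m n)
  ... | Bézout.+- a b d+b*n≡a*m = x^k≈1∧x^l≈1⇒x^[a*k-b*l]≈1 (gcd m n) a b xᵐ≈1 xⁿ≈1 d+b*n≡a*m
  ... | Bézout.-+ a b d+a*m≡b*n = x^k≈1∧x^l≈1⇒x^[a*k-b*l]≈1 (gcd m n) b a xⁿ≈1 xᵐ≈1 d+a*m≡b*n

  ⁻¹-unique : ∀ {x y} → x * y ≈ 1# → y ≈ x ⁻¹
  ⁻¹-unique {x} {y} xy≈1 with toSum (x ≟ 0#)
  ... | inj₁ x≈0 = ⊥-elim (1≉0 (trans (sym xy≈1) (trans (*-congʳ x≈0) (zeroˡ y))))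
  ... | inj₂ x≉0 = *-cancelˡ x≉0 (trans xy≈1 (sym (x*x⁻¹≈1 x≉0)))

  x⁻¹≉0 : ∀ {x} → x ≉ 0# → x ⁻¹ ≉ 0#
  x⁻¹≉0 x≉0 x⁻¹≈0 = 1≉0 (trans (sym (x*x⁻¹≈1 x≉0)) (trans (*-congˡ x⁻¹≈0) (zeroʳ _)))

  ⁻¹-cong : ∀ {x y} → x ≈ y → x ⁻¹ ≈ y ⁻¹
  ⁻¹-cong {x} {y} x≈y with toSum (x ≟ 0#)
  ... | inj₁ x≈0 = trans (0⁻¹≈0 x≈0) (sym (0⁻¹≈0 (trans (sym x≈y) x≈0)))
  ... | inj₂ x≉0 = ⁻¹-unique (trans (*-congʳ (sym x≈y)) (x*x⁻¹≈1 x≉0))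

  ⁻¹-^ : ∀ {x} n → x ≉ 0# → x ⁻¹ ^ n ≈ (x ^ n) ⁻¹
  ⁻¹-^ {x} n x≉0 = ⁻¹-unique (begin
    x ^ n * x ⁻¹ ^ n   ≈⟨ ^-distrib-* x (x ⁻¹) n ⟨
    (x * x ⁻¹) ^ n     ≈⟨ ^-congˡ n (x*x⁻¹≈1 x≉0) ⟩
    1# ^ n             ≈⟨ 1^n≈1 n ⟩
    1#                 ∎)

  -‿⁻¹ : ∀ {x} → x ≉ 0# → (- x) ⁻¹ ≈ - x ⁻¹
  -‿⁻¹ {x} x≉0 = sym (⁻¹-unique (trans (solve 2 (λ a b → (:- a) :* (:- b) := a :* b) refl x (x ⁻¹)) (x*x⁻¹≈1 x≉0)))

  -- `PolyFun m a g`: g is a polynomial function of degree at most m whose coefficient of xᵐ is a,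
  -- encoded through the factor theorem instead of coefficient lists.
  PolyFun : ℕ → Carrier → (Carrier → Carrier) → Set (c ⊔ ℓ)
  PolyFun zero    a g = ∀ x → g x ≈ a
  PolyFun (suc m) a g = ∀ r → ∃ λ h → PolyFun m a h × (∀ x → g x ≈ (x - r) * h x + g r)


  length-roots≤degree : ∀ {m a g rs} → a ≉ 0# → PolyFun m a g → Unique rs →
                        (∀ {r} → r ∈ rs → g r ≈ 0#) → length rs ≤ m
  length-roots≤degree {rs = []}     _   _  _ _ = z≤n
  length-roots≤degree {zero} {rs = r ∷ _} a≉0 g≈a _ roots = ⊥-elim (a≉0 (trans (sym (g≈a r)) (roots (here refl))))
  length-roots≤degree {suc m} {g = g} {rs = r ∷ rs} a≉0 pg u roots with pg r
  ... | h , ph , g≈[x-r]h+gr = s≤s (length-roots≤degree a≉0 ph (tail u) h-roots)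
    where
    h-roots : ∀ {s} → s ∈ rs → h s ≈ 0#
    h-roots {s} s∈rs = [ (λ s-r≈0 → ⊥-elim (≉-head u s∈rs (x-y≈0⇒x≈y s-r≈0))) , id ]′
      (x*y≈0⇒x≈0⊎y≈0 (begin
        (s - r) * h s         ≈⟨ +-identityʳ _ ⟨
        (s - r) * h s + 0#    ≈⟨ +-congˡ (roots (here refl)) ⟨
        (s - r) * h s + g r   ≈⟨ g≈[x-r]h+gr s ⟨
        g s                   ≈⟨ roots (there s∈rs) ⟩
        0#                    ∎))

  PolyFun-cong : ∀ m {a b g g′} → a ≈ b → (∀ x → g x ≈ g′ x) → PolyFun m a g → PolyFun m b g′
  PolyFun-cong zero    a≈b g≈g′ pg x = trans (sym (g≈g′ x)) (trans (pg x) a≈b)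
  PolyFun-cong (suc m) a≈b g≈g′ pg r with h , ph , g≈ ← pg r =
    h , PolyFun-cong m a≈b (λ _ → refl) ph , λ x → trans (sym (g≈g′ x)) (trans (g≈ x) (+-congˡ (g≈g′ r)))

  PolyFun-+ : ∀ m {a b g h} → PolyFun m a g → PolyFun m b h → PolyFun m (a + b) (λ x → g x + h x)
  PolyFun-+ zero    pg ph x = +-cong (pg x) (ph x)
  PolyFun-+ (suc m) {g = g} {h} pg ph r with k , pk , g≈ ← pg r | l , pl , h≈ ← ph r =
    (λ x → k x + l x) , PolyFun-+ m pk pl , λ x → begin
      g x + h x                                           ≈⟨ +-cong (g≈ x) (h≈ x) ⟩
      ((x - r) * k x + g r) + ((x - r) * l x + h r)
        ≈⟨ solve 6 (λ x r k l gr hr → ((x :- r) :* k :+ gr) :+ ((x :- r) :* l :+ hr) := (x :- r) :* (k :+ l) :+ (gr :+ hr))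
                   refl x r (k x) (l x) (g r) (h r) ⟩
      (x - r) * (k x + l x) + (g r + h r)                 ∎

  PolyFun-* : ∀ m s {a g} → PolyFun m a g → PolyFun m (s * a) (λ x → s * g x)
  PolyFun-* zero    s pg x = *-congˡ (pg x)
  PolyFun-* (suc m) s {g = g} pg r with k , pk , g≈ ← pg r =
    (λ x → s * k x) , PolyFun-* m s pk , λ x → begin
      s * g x                          ≈⟨ *-congˡ (g≈ x) ⟩
      s * ((x - r) * k x + g r)
        ≈⟨ solve 5 (λ s x r k gr → s :* ((x :- r) :* k :+ gr) := (x :- r) :* (s :* k) :+ s :* gr) refl s x r (k x) (g r) ⟩
      (x - r) * (s * k x) + s * g r    ∎

  PolyFun-suc : ∀ m {a g} → PolyFun m a g → PolyFun (suc m) 0# g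
  PolyFun-suc zero {g = g} g≈a r = (λ _ → 0#) , (λ _ → refl) , λ x → begin
    g x                  ≈⟨ trans (g≈a x) (sym (g≈a r)) ⟩
    g r                  ≈⟨ +-identityˡ _ ⟨
    0# + g r             ≈⟨ +-congʳ (zeroʳ _) ⟨
    (x - r) * 0# + g r   ∎
  PolyFun-suc (suc m) pg r with h , ph , g≈ ← pg r = h , PolyFun-suc m ph , g≈

  PolyFun-lift : ∀ {m m′ a g} → m < m′ → PolyFun m a g → PolyFun m′ 0# g
  PolyFun-lift {m} {suc m′} (s≤s m≤m′) pg with ℕ.m≤n⇒m<n∨m≡n m≤m′
  ... | inj₁ m<m′    = PolyFun-suc m′ (PolyFun-lift m<m′ pg)
  ... | inj₂ ≡.refl = PolyFun-suc m pg

  PolyFun-x* : ∀ m {a g} → PolyFun m a g → PolyFun (suc m) a (λ x → x * g x)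
  PolyFun-x* zero {g = g} g≈a r = g , g≈a , λ x → begin
    x * g x                    ≈⟨ solve 3 (λ x r g → x :* g := (x :- r) :* g :+ r :* g) refl x r (g x) ⟩
    (x - r) * g x + r * g x    ≈⟨ +-congˡ (*-congˡ (trans (g≈a x) (sym (g≈a r)))) ⟩
    (x - r) * g x + r * g r    ∎
  PolyFun-x* (suc m) {a} {g} pg r with k , pk , g≈ ← pg r =
    (λ x → g x + r * k x) ,
    PolyFun-cong (suc m) (+-identityʳ a) (λ _ → refl) (PolyFun-+ (suc m) pg (PolyFun-suc m (PolyFun-* m r pk))) ,
    λ x → begin
      x * g x                                              ≈⟨ *-congˡ (g≈ x) ⟩
      x * ((x - r) * k x + g r)
        ≈⟨ solve 4 (λ x r k gr → x :* ((x :- r) :* k :+ gr) := (x :- r) :* (((x :- r) :* k :+ gr) :+ r :* k) :+ r :* gr)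
                   refl x r (k x) (g r) ⟩
      (x - r) * (((x - r) * k x + g r) + r * k x) + r * g r ≈⟨ +-congʳ (*-congˡ (+-congʳ (g≈ x))) ⟨
      (x - r) * (g x + r * k x) + r * g r                  ∎

  PolyFun-^ : ∀ m → PolyFun m 1# (_^ m)
  PolyFun-^ zero    _ = refl
  PolyFun-^ (suc m) = PolyFun-x* m (PolyFun-^ m)

  PolyFun-^* : ∀ d m {a g} → PolyFun m a g → PolyFun (d ℕ.+ m) a (λ x → x ^ d * g x)
  PolyFun-^* zero    m pg = PolyFun-cong m refl (λ _ → sym (*-identityˡ _)) pg
  PolyFun-^* (suc d) m {g = g} pg =
    PolyFun-cong (suc (d ℕ.+ m)) refl (λ x → sym (*-assoc x (x ^ d) (g x))) (PolyFun-x* (d ℕ.+ m) (PolyFun-^* d m pg))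

  PolyFun-^-lower : ∀ {m k a g} → k < m → PolyFun k a g → PolyFun m 1# (λ x → x ^ m - g x)
  PolyFun-^-lower {m} {g = g} k<m pg = PolyFun-cong m (+-identityʳ 1#) (λ x → +-congˡ (-1*x≈-x (g x)))
    (PolyFun-+ m (PolyFun-^ m) (PolyFun-lift k<m (PolyFun-* _ (- 1#) pg)))

  geo : Carrier → ℕ → Carrier
  geo y zero    = 0#
  geo y (suc j) = 1# + y * geo y j

  [y-1]*geo≈y^j-1 : ∀ y j → (y - 1#) * geo y j ≈ y ^ j - 1#
  [y-1]*geo≈y^j-1 y zero    = trans (zeroʳ _) (sym (-‿inverseʳ 1#))
  [y-1]*geo≈y^j-1 y (suc j) = begin
    (y - 1#) * (1# + y * geo y j)
      ≈⟨ solve 2 (λ y g → (y :- con (+ 1)) :* (con (+ 1) :+ y :* g)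
                       := (y :- con (+ 1)) :+ y :* ((y :- con (+ 1)) :* g)) refl y (geo y j) ⟩
    (y - 1#) + y * ((y - 1#) * geo y j)   ≈⟨ +-congˡ (*-congˡ ([y-1]*geo≈y^j-1 y j)) ⟩
    (y - 1#) + y * (y ^ j - 1#)
      ≈⟨ solve 2 (λ y Y → (y :- con (+ 1)) :+ y :* (Y :- con (+ 1)) := y :* Y :- con (+ 1)) refl y (y ^ j) ⟩
    y * y ^ j - 1#                        ∎

  PolyFun-geo : ∀ {d} → 0 < d → ∀ j → PolyFun (d ℕ.* j) 1# (λ x → geo (x ^ d) (suc j))
  PolyFun-geo {d} _ zero = ≡.subst (λ k → PolyFun k 1# (λ x → geo (x ^ d) 1)) (≡.sym (ℕ.*-zeroʳ d))
    (λ x → trans (+-congˡ (zeroʳ _)) (+-identityʳ 1#))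
  PolyFun-geo {d} 0<d (suc j) = ≡.subst (λ k → PolyFun k 1# (λ x → geo (x ^ d) (2 ℕ.+ j))) (≡.sym (ℕ.*-suc d j))
    (PolyFun-cong (d ℕ.+ d ℕ.* j) (+-identityˡ 1#) (λ _ → refl)
      (PolyFun-+ (d ℕ.+ d ℕ.* j) (PolyFun-lift {g = λ _ → 1#} (ℕ.<-≤-trans 0<d (ℕ.m≤m+n d _)) (λ _ → refl))
                                (PolyFun-^* d (d ℕ.* j) (PolyFun-geo 0<d j))))


  ≉0-resp : ∀ {y z} → y ≈ z → y ≉ 0# → z ≉ 0#
  ≉0-resp y≈z y≉0 z≈0 = y≉0 (trans y≈z z≈0)

  1+length-filter≉0 : ∀ {p} {P : Pred Carrier p} {xs} → Listing P xs → P 0# →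
                      suc (length (filter (∁? (_≟ 0#)) xs)) ≡ length xs
  1+length-filter≉0 {P = P} {xs} xs-lists P0 =
    ≡.trans (≡.cong (ℕ._+ length (filter (∁? (_≟ 0#)) xs)) (≡.sym |zeros|≡1)) (length-filter+length-filter-∁ (_≟ 0#) xs)
    where
    zeros-lists : Listing (P ∩ (_≈ 0#)) (filter (_≟ 0#) xs)
    zeros-lists = Listing-filter (_≟ 0#) (λ y≈z y≈0 → trans (sym y≈z) y≈0) xs-lists
    [0]-lists : Listing (P ∩ (_≈ 0#)) (0# ∷ [])
    [0]-lists = record
      { unique   = [] ∷ []
      ; sound    = λ { (here z≈0) → Listing.resp xs-lists (sym z≈0) P0 , z≈0 }
      ; complete = λ (_ , z≈0) → here z≈0
      }
    |zeros|≡1 : length (filter (_≟ 0#) xs) ≡ 1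
    |zeros|≡1 = Listing-length zeros-lists [0]-lists

  module FiniteMultiplicativeSubgroup {g} {G : Pred Carrier g} {Gs : List Carrier}
    (Gs-lists-G : Listing G Gs) (G⇒≉0 : ∀ {x} → G x → x ≉ 0#)
    (G-1 : G 1#) (G-* : ∀ {x y} → G x → G y → G (x * y)) (G-⁻¹ : ∀ {x} → G x → G (x ⁻¹)) where

    open CommutativeMonoidFold *-commutativeMonoid using (fold; length·x∙fold≈fold)

    0<|G| : 0 < length Gs
    0<|G| = ∈-length setoid (Listing.complete Gs-lists-G G-1)

    private
      fold≉0 : ∀ xs → (∀ {z} → z ∈ xs → z ≉ 0#) → fold xs ≉ 0#
      fold≉0 []       _   = 1≉0
      fold≉0 (x ∷ xs) xs≉0 = x≉0∧y≉0⇒x*y≉0 (xs≉0 (here refl)) (fold≉0 xs (xs≉0 ∘ there))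

    x^|G|≈1 : ∀ {x} → G x → x ^ length Gs ≈ 1#
    x^|G|≈1 {x} Gx = *-cancelʳ (fold≉0 Gs (G⇒≉0 ∘ Listing.sound Gs-lists-G)) (begin
      x ^ length Gs * fold Gs  ≈⟨ length·x∙fold≈fold Gs-lists-G (*-cancelˡ (G⇒≉0 Gx)) (G-* Gx) onto ⟩
      fold Gs                  ≈⟨ *-identityˡ _ ⟨
      1# * fold Gs             ∎)
      where
      onto : ∀ {z} → G z → ∃ λ y → G y × z ≈ x * y
      onto {z} Gz = x ⁻¹ * z , G-* (G-⁻¹ Gx) Gz , sym (x*[x⁻¹*y]≈y z (G⇒≉0 Gx))

    nthRoots : ℕ → Carrier → List Carrier
    nthRoots n γ = filter (λ v → (v ^ n) ≟ γ) Gs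

    nthRoots-lists : ∀ n γ → Listing (G ∩ λ v → v ^ n ≈ γ) (nthRoots n γ)
    nthRoots-lists n γ =
      Listing-filter (λ v → (v ^ n) ≟ γ) (λ u≈v uⁿ≈γ → trans (^-congˡ n (sym u≈v)) uⁿ≈γ) Gs-lists-G

    private
      ^≈1? : ∀ d → Unary.Decidable (λ w → w ^ d ≈ 1#)
      ^≈1? d w = (w ^ d) ≟ 1#

      length-rootsOfUnity≤ : ∀ {d} → 0 < d → length (nthRoots d 1#) ≤ d
      length-rootsOfUnity≤ {d} 0<d = length-roots≤degree 1≉0 (PolyFun-^-lower {g = λ _ → 1#} 0<d (λ _ → refl))
        (Listing.unique (nthRoots-lists d 1#))
        (λ w∈ → trans (+-congʳ (proj₂ (Listing.sound (nthRoots-lists d 1#) w∈))) (-‿inverseʳ 1#))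

      length-nonRootsOfUnity≤ : ∀ {d} e → 0 < d → length Gs ≡ suc e ℕ.* d →
                                length (filter (∁? (^≈1? d)) Gs) ≤ d ℕ.* e
      length-nonRootsOfUnity≤ {d} e 0<d |G|≡[1+e]*d =
        length-roots≤degree 1≉0 (PolyFun-geo 0<d e) (Listing.unique non-roots-lists) geo≈0
        where
        non-roots-lists : Listing (G ∩ ∁ (λ w → w ^ d ≈ 1#)) (filter (∁? (^≈1? d)) Gs)
        non-roots-lists =
          Listing-filter (∁? (^≈1? d)) (λ u≈v uᵈ≉1 vᵈ≈1 → uᵈ≉1 (trans (^-congˡ d u≈v) vᵈ≈1)) Gs-lists-G
        d*[1+e]≡|G| : d ℕ.* suc e ≡ length Gs
        d*[1+e]≡|G| = ≡.trans (ℕ.*-comm d (suc e)) (≡.sym |G|≡[1+e]*d)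
        geo≈0 : ∀ {w} → w ∈ filter (∁? (^≈1? d)) Gs → geo (w ^ d) (suc e) ≈ 0#
        geo≈0 {w} w∈ with Gw , wᵈ≉1 ← Listing.sound non-roots-lists w∈ =
          [ (λ wᵈ-1≈0 → ⊥-elim (wᵈ≉1 (x-y≈0⇒x≈y wᵈ-1≈0))) , id ]′ (x*y≈0⇒x≈0⊎y≈0 (begin
            (w ^ d - 1#) * geo (w ^ d) (suc e)  ≈⟨ [y-1]*geo≈y^j-1 (w ^ d) (suc e) ⟩
            (w ^ d) ^ suc e - 1#                ≈⟨ +-congʳ (^-assocʳ w d (suc e)) ⟩
            w ^ (d ℕ.* suc e) - 1#              ≡⟨ ≡.cong (λ k → w ^ k - 1#) d*[1+e]≡|G| ⟩
            w ^ length Gs - 1#                  ≈⟨ +-congʳ (x^|G|≈1 Gw) ⟩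
            1# - 1#                             ≈⟨ -‿inverseʳ 1# ⟩
            0#                                  ∎))

      rootsOfUnity-length≥ : ∀ {d} e → 0 < d → length Gs ≡ suc e ℕ.* d → d ≤ length (nthRoots d 1#)
      rootsOfUnity-length≥ {d} e 0<d |G|≡[1+e]*d = ℕ.+-cancelʳ-≤ (d ℕ.* e) d _
        (≡.subst (_≤ length (nthRoots d 1#) ℕ.+ d ℕ.* e) |roots|+|nonRoots|≡d+d*e
          (ℕ.+-monoʳ-≤ (length (nthRoots d 1#)) (length-nonRootsOfUnity≤ e 0<d |G|≡[1+e]*d)))
        where
        |roots|+|nonRoots|≡d+d*e : length (nthRoots d 1#) ℕ.+ length (filter (∁? (^≈1? d)) Gs) ≡ d ℕ.+ d ℕ.* e
        |roots|+|nonRoots|≡d+d*e = ≡.trans (length-filter+length-filter-∁ (^≈1? d) Gs)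
          (≡.trans |G|≡[1+e]*d (≡.trans (ℕ.*-comm (suc e) d) (ℕ.*-suc d e)))

    length-rootsOfUnity : ∀ {d} → d ∣ length Gs → length (nthRoots d 1#) ≡ d
    length-rootsOfUnity {d} (divides e |G|≡e*d) with e | d | |G|≡e*d
    ... | zero   | _      | |G|≡0       = ⊥-elim (ℕ.<⇒≢ 0<|G| (≡.sym |G|≡0))
    ... | suc e′ | zero   | |G|≡e′*0    = ⊥-elim (ℕ.<⇒≢ 0<|G| (≡.sym (≡.trans |G|≡e′*0 (ℕ.*-zeroʳ e′))))
    ... | suc e′ | suc d′ | |G|≡[1+e′]*d =
      ℕ.≤-antisym (length-rootsOfUnity≤ (s≤s z≤n)) (rootsOfUnity-length≥ e′ (s≤s z≤n) |G|≡[1+e′]*d)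

    length-nthRoots-of-root : ∀ {n γ v₀} → v₀ ∈ nthRoots n γ → length (nthRoots n γ) ≡ gcd n (length Gs)
    length-nthRoots-of-root {n} {γ} {v₀} v₀∈ =
      ≡.trans (Listing-length (nthRoots-lists n γ) v₀*roots-lists)
        (≡.trans (List.length-map (v₀ *_) (nthRoots d 1#)) (length-rootsOfUnity (gcd[m,n]∣n n (length Gs))))
      where
      d : ℕ
      d = gcd n (length Gs)
      Gv₀ : G v₀
      Gv₀ = proj₁ (Listing.sound (nthRoots-lists n γ) v₀∈)
      v₀ⁿ≈γ : v₀ ^ n ≈ γ
      v₀ⁿ≈γ = proj₂ (Listing.sound (nthRoots-lists n γ) v₀∈)
      v₀≉0 : v₀ ≉ 0#
      v₀≉0 = G⇒≉0 Gv₀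
      v₀*-maps : ∀ {w} → G w × w ^ d ≈ 1# → G (v₀ * w) × (v₀ * w) ^ n ≈ γ
      v₀*-maps {w} (Gw , wᵈ≈1) = G-* Gv₀ Gw , (begin
        (v₀ * w) ^ n     ≈⟨ ^-distrib-* v₀ w n ⟩
        v₀ ^ n * w ^ n   ≈⟨ *-cong v₀ⁿ≈γ (x^m≈1⇒x^n≈1 (gcd[m,n]∣m n (length Gs)) wᵈ≈1) ⟩
        γ * 1#           ≈⟨ *-identityʳ γ ⟩
        γ                ∎)
      v₀*-onto : ∀ {z} → G z × z ^ n ≈ γ → ∃ λ w → (G w × w ^ d ≈ 1#) × z ≈ v₀ * w
      v₀*-onto {z} (Gz , zⁿ≈γ) = v₀ ⁻¹ * z , (Gw , x^m≈1∧x^n≈1⇒x^gcd≈1 n (length Gs) wⁿ≈1 (x^|G|≈1 Gw)) ,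
                                  sym (x*[x⁻¹*y]≈y z v₀≉0)
        where
        Gw : G (v₀ ⁻¹ * z)
        Gw = G-* (G-⁻¹ Gv₀) Gz
        wⁿ≈1 : (v₀ ⁻¹ * z) ^ n ≈ 1#
        wⁿ≈1 = begin
          (v₀ ⁻¹ * z) ^ n         ≈⟨ ^-distrib-* (v₀ ⁻¹) z n ⟩
          v₀ ⁻¹ ^ n * z ^ n       ≈⟨ *-cong (⁻¹-^ n v₀≉0) (trans zⁿ≈γ (sym v₀ⁿ≈γ)) ⟩
          (v₀ ^ n) ⁻¹ * v₀ ^ n    ≈⟨ x⁻¹*x≈1 (x^n≉0 n v₀≉0) ⟩
          1#                      ∎
      v₀*roots-lists : Listing (G ∩ λ v → v ^ n ≈ γ) (map (v₀ *_) (nthRoots d 1#))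
      v₀*roots-lists = Listing-map *-congˡ (λ _ _ → *-cancelˡ v₀≉0) v₀*-maps v₀*-onto
                         (Listing.resp (nthRoots-lists n γ)) (nthRoots-lists d 1#)

    length-nthRoots : ∀ n γ → length (nthRoots n γ) ≡ 0 ⊎ length (nthRoots n γ) ≡ gcd n (length Gs)
    length-nthRoots n γ with nthRoots n γ in roots≡
    ... | []     = inj₁ ≡.refl
    ... | v₀ ∷ _ = inj₂ (≡.subst (λ vs → length vs ≡ gcd n (length Gs)) roots≡
                     (length-nthRoots-of-root {n} (≡.subst (v₀ ∈_) (≡.sym roots≡) (here refl))))

  module FiniteField {N} (enumeration : Enumeration K N) where

    open import Algebra.Properties.Semiring.Mult semiring using (×1-homo-*) renaming (_×_ to _·_)

    elements : List Carrier
    elements = map (proj₁ enumeration) (allFin N)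

    elements-lists : Listing U elements
    elements-lists = record
      { unique   = map⁺ (≡.setoid (Fin N)) setoid (proj₁ (proj₂ enumeration) _ _) (Uniqueₚ.allFin⁺ N)
      ; sound    = _
      ; complete = λ {z} _ → let i , eᵢ≈z = proj₂ (proj₂ enumeration) z in
                   ∈-resp-≈ setoid eᵢ≈z
                     (∈-map⁺ (≡.setoid (Fin N)) setoid (λ { ≡.refl → refl }) (Membershipₚ.∈-allFin i))
      }

    length-elements : length elements ≡ N
    length-elements = ≡.trans (List.length-map _ (allFin N)) (List.length-tabulate id)

    preimageCount≡length : ∀ {g : Carrier → Carrier} {α xs} → (∀ {x y} → x ≈ y → g x ≈ g y) →
                           Listing (λ x → g x ≈ α) xs → preimageCount K _≟_ N (proj₁ enumeration) g α ≡ length xs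
    preimageCount≡length {g} {α} g-cong xs-lists = ≡.trans (≡.sym (List.length-map e indices))
      (Listing-length preimages-lists xs-lists)
      where
      e : Fin N → Carrier
      e = proj₁ enumeration
      indices : List (Fin N)
      indices = filter (λ i → g (e i) ≟ α) (allFin N)
      preimages-lists : Listing (λ x → g x ≈ α) (map e indices)
      preimages-lists = record
        { unique   = map⁺ (≡.setoid (Fin N)) setoid (proj₁ (proj₂ enumeration) _ _)
                       (Uniqueₚ.filter⁺ (λ i → g (e i) ≟ α) (Uniqueₚ.allFin⁺ N))
        ; sound    = λ x∈ → let i , i∈ , x≈eᵢ = ∈-map⁻ (≡.setoid (Fin N)) setoid x∈ in
                     trans (g-cong x≈eᵢ) (proj₂ (Membershipₚ.∈-filter⁻ (λ i → g (e i) ≟ α) {xs = allFin N} i∈))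
        ; complete = λ {x} gx≈α → let i , eᵢ≈x = proj₂ (proj₂ enumeration) x in
                     ∈-resp-≈ setoid eᵢ≈x (∈-map⁺ (≡.setoid (Fin N)) setoid (λ { ≡.refl → refl })
                       (Membershipₚ.∈-filter⁺ (λ i → g (e i) ≟ α) (Membershipₚ.∈-allFin i)
                         (trans (g-cong eᵢ≈x) gx≈α)))
        }

    N·x≈0 : ∀ x → N · x ≈ 0#
    N·x≈0 x = +-identityˡ-unique (N · x) Σ (begin
      N · x + Σ                 ≡⟨ ≡.cong (λ k → k · x + Σ) length-elements ⟨
      length elements · x + Σ   ≈⟨ length·x∙fold≈fold elements-lists (+-cancelˡ x _ _) _ translate ⟩
      Σ                         ∎)
      where
      open CommutativeMonoidFold +-commutativeMonoid using (fold; length·x∙fold≈fold)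
      Σ : Carrier
      Σ = fold elements
      translate : ∀ {z} → U z → ∃ λ y → U y × z ≈ x + y
      translate {z} _ = - x + z , _ , solve 2 (λ x z → z := x :+ (:- x :+ z)) refl x z

    [m^j]·1≈[m·1]^j : ∀ m j → (m ℕ.^ j) · 1# ≈ (m · 1#) ^ j
    [m^j]·1≈[m·1]^j m zero    = +-identityʳ 1#
    [m^j]·1≈[m·1]^j m (suc j) = trans (×1-homo-* m (m ℕ.^ j)) (*-congˡ ([m^j]·1≈[m·1]^j m j))

    p·1≈0 : ∀ {p j} → N ≡ p ℕ.^ j → p · 1# ≈ 0#
    p·1≈0 {p} {j} N≡p^j = x^n≈0⇒x≈0 j (begin
      (p · 1#) ^ j       ≈⟨ [m^j]·1≈[m·1]^j p j ⟨
      (p ℕ.^ j) · 1#     ≡⟨ ≡.cong (_· 1#) N≡p^j ⟨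
      N · 1#             ≈⟨ N·x≈0 1# ⟩
      0#                 ∎)

    nonzero : List Carrier
    nonzero = filter (∁? (_≟ 0#)) elements

    nonzero-lists : Listing (U ∩ (_≉ 0#)) nonzero
    nonzero-lists = Listing-filter (∁? (_≟ 0#)) ≉0-resp elements-lists

    1+|nonzero|≡N : suc (length nonzero) ≡ N
    1+|nonzero|≡N = ≡.trans (1+length-filter≉0 elements-lists _) length-elements

    module K* = FiniteMultiplicativeSubgroup nonzero-lists proj₂ (_ , 1≉0)
      (λ (_ , x≉0) (_ , y≉0) → _ , x≉0∧y≉0⇒x*y≉0 x≉0 y≉0) (λ (_ , x≉0) → _ , x⁻¹≉0 x≉0)

    x^N≈x : ∀ x → x ^ N ≈ x
    x^N≈x x with toSum (x ≟ 0#)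
    ... | inj₁ x≈0 = begin
      x ^ N                      ≡⟨ ≡.cong (x ^_) 1+|nonzero|≡N ⟨
      x * x ^ length nonzero     ≈⟨ *-congʳ x≈0 ⟩
      0# * x ^ length nonzero    ≈⟨ zeroˡ _ ⟩
      0#                         ≈⟨ x≈0 ⟨
      x                          ∎
    ... | inj₂ x≉0 = begin
      x ^ N                      ≡⟨ ≡.cong (x ^_) 1+|nonzero|≡N ⟨
      x * x ^ length nonzero     ≈⟨ *-congˡ (K*.x^|G|≈1 (_ , x≉0)) ⟩
      x * 1#                     ≈⟨ *-identityʳ x ⟩
      x                          ∎

  module QuadraticExtension {p k} (p-prime : Prime p) (1≤k : 1 ≤ k)
    (enumeration : Enumeration K (p ℕ.^ k ℕ.* p ℕ.^ k)) {β : Carrier}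
    (β∉F : ¬ InSubfield K (p ℕ.^ k) β) (β²∈F : InSubfield K (p ℕ.^ k) (β * β)) (2≉0 : 1# + 1# ≉ 0#) where

    open FiniteField enumeration

    q : ℕ
    q = p ℕ.^ k

    InF : Pred Carrier ℓ
    InF = InSubfield K q

    1<q : 1 < q
    1<q = ℕ.<-≤-trans p>1 (≡.subst (_≤ q) (ℕ.*-identityʳ p) (ℕ.^-monoʳ-≤ p {{ℕ.>-nonZero (ℕ.<⇒≤ p>1)}} 1≤k))
      where p>1 = ℕ.nonTrivial⇒n>1 p {{prime⇒nonTrivial p-prime}}

    0<q : 0 < q
    0<q = ℕ.<-trans (s≤s z≤n) 1<q

    +-^q : ∀ x y → (x + y) ^ q ≈ x ^ q + y ^ q
    +-^q = Frobenius.frobenius-^ K p-prime (p·1≈0 {p} {k ℕ.+ k} (≡.sym (ℕ.^-distribˡ-+-* p k k))) k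

    -‿^q : ∀ x → (- x) ^ q ≈ - (x ^ q)
    -‿^q x = begin
      (- x) ^ q                          ≈⟨ solve 2 (λ y z → z := (:- y) :+ (y :+ z)) refl (x ^ q) ((- x) ^ q) ⟩
      - (x ^ q) + (x ^ q + (- x) ^ q)    ≈⟨ +-congˡ (+-^q x (- x)) ⟨
      - (x ^ q) + (x - x) ^ q            ≈⟨ +-congˡ (trans (^-congˡ q (-‿inverseʳ x)) (0^n≈0 0<q)) ⟩
      - (x ^ q) + 0#                     ≈⟨ +-identityʳ _ ⟩
      - (x ^ q)                          ∎

    *-^q : ∀ x y → (x * y) ^ q ≈ x ^ q * y ^ q
    *-^q x y = ^-distrib-* x y q

    x^q^q≈x : ∀ x → (x ^ q) ^ q ≈ x
    x^q^q≈x x = trans (^-assocʳ x q q) (x^N≈x x)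

    InF-resp : ∀ {x y} → x ≈ y → InF x → InF y
    InF-resp x≈y xᵠ≈x = trans (^-congˡ q (sym x≈y)) (trans xᵠ≈x x≈y)

    InF-0 : InF 0#
    InF-0 = 0^n≈0 0<q

    InF-1 : InF 1#
    InF-1 = 1^n≈1 q

    InF-+ : ∀ {x y} → InF x → InF y → InF (x + y)
    InF-+ xᵠ≈x yᵠ≈y = trans (+-^q _ _) (+-cong xᵠ≈x yᵠ≈y)

    InF-* : ∀ {x y} → InF x → InF y → InF (x * y)
    InF-* xᵠ≈x yᵠ≈y = trans (*-^q _ _) (*-cong xᵠ≈x yᵠ≈y)

    InF-neg : ∀ {x} → InF x → InF (- x)
    InF-neg xᵠ≈x = trans (-‿^q _) (-‿cong xᵠ≈x)

    InF-^ : ∀ {x} n → InF x → InF (x ^ n)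
    InF-^ {x} n xᵠ≈x = begin
      (x ^ n) ^ q     ≈⟨ ^-assocʳ x n q ⟩
      x ^ (n ℕ.* q)   ≡⟨ ≡.cong (x ^_) (ℕ.*-comm n q) ⟩
      x ^ (q ℕ.* n)   ≈⟨ ^-assocʳ x q n ⟨
      (x ^ q) ^ n     ≈⟨ ^-congˡ n xᵠ≈x ⟩
      x ^ n           ∎

    InF-⁻¹ : ∀ {x} → InF x → InF (x ⁻¹)
    InF-⁻¹ {x} xᵠ≈x with toSum (x ≟ 0#)
    ... | inj₁ x≈0 = InF-resp (sym (0⁻¹≈0 x≈0)) InF-0
    ... | inj₂ x≉0 = trans (⁻¹-^ q x≉0) (⁻¹-cong xᵠ≈x)

    β^q≈-β : β ^ q ≈ - β
    β^q≈-β = [ ⊥-elim ∘ β∉F ∘ x-y≈0⇒x≈y , βᵠ+β≈0⇒βᵠ≈-β ]′ (x*y≈0⇒x≈0⊎y≈0 (begin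
      (β ^ q - β) * (β ^ q + β)   ≈⟨ solve 2 (λ x b → (x :- b) :* (x :+ b) := x :* x :- b :* b) refl (β ^ q) β ⟩
      β ^ q * β ^ q - β * β       ≈⟨ +-congʳ (*-^q β β) ⟨
      (β * β) ^ q - β * β         ≈⟨ +-congʳ β²∈F ⟩
      β * β - β * β               ≈⟨ -‿inverseʳ _ ⟩
      0#                          ∎))
      where
      βᵠ+β≈0⇒βᵠ≈-β : β ^ q + β ≈ 0# → β ^ q ≈ - β
      βᵠ+β≈0⇒βᵠ≈-β βᵠ+β≈0 = begin
        β ^ q               ≈⟨ solve 2 (λ x b → x := (x :+ b) :- b) refl (β ^ q) β ⟩
        (β ^ q + β) - β     ≈⟨ +-congʳ βᵠ+β≈0 ⟩
        0# - β              ≈⟨ +-identityˡ _ ⟩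
        - β                 ∎

    β≉0 : β ≉ 0#
    β≉0 β≈0 = β∉F (InF-resp (sym β≈0) InF-0)

    decompose : ∀ x → ∃ λ u → ∃ λ v → InF u × InF v × x ≈ u + v * β
    decompose x = u , v , InF-u , InF-v , x≈u+vβ
      where
      -- Solve x = u + vβ together with its conjugate x^q = u - vβ.
      u v : Carrier
      u = (x + x ^ q) * (1# + 1#) ⁻¹
      v = (x - x ^ q) * ((1# + 1#) ⁻¹ * β ⁻¹)
      InF-u : InF u
      InF-u = begin
        ((x + x ^ q) * (1# + 1#) ⁻¹) ^ q            ≈⟨ *-^q _ _ ⟩
        (x + x ^ q) ^ q * ((1# + 1#) ⁻¹) ^ q        ≈⟨ *-cong (+-^q _ _) (InF-⁻¹ (InF-+ InF-1 InF-1)) ⟩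
        (x ^ q + (x ^ q) ^ q) * (1# + 1#) ⁻¹        ≈⟨ *-congʳ (trans (+-congˡ (x^q^q≈x x)) (+-comm _ _)) ⟩
        (x + x ^ q) * (1# + 1#) ⁻¹                  ∎
      InF-v : InF v
      InF-v = begin
        ((x - x ^ q) * ((1# + 1#) ⁻¹ * β ⁻¹)) ^ q
          ≈⟨ trans (*-^q _ _) (*-congˡ (*-^q _ _)) ⟩
        (x - x ^ q) ^ q * (((1# + 1#) ⁻¹) ^ q * (β ⁻¹) ^ q)
          ≈⟨ *-cong (trans (+-^q _ _) (+-congˡ (trans (-‿^q _) (-‿cong (x^q^q≈x x)))))
                    (*-cong (InF-⁻¹ (InF-+ InF-1 InF-1))
                            (trans (⁻¹-^ q β≉0) (trans (⁻¹-cong β^q≈-β) (-‿⁻¹ β≉0)))) ⟩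
        (x ^ q - x) * ((1# + 1#) ⁻¹ * - β ⁻¹)
          ≈⟨ solve 4 (λ x y i j → (y :- x) :* (i :* (:- j)) := (x :- y) :* (i :* j)) refl x (x ^ q) _ _ ⟩
        (x - x ^ q) * ((1# + 1#) ⁻¹ * β ⁻¹)         ∎
      x≈u+vβ : x ≈ u + v * β
      x≈u+vβ = begin
        x                                                            ≈⟨ *-identityʳ x ⟨
        x * 1#                                                       ≈⟨ *-congˡ (x*x⁻¹≈1 2≉0) ⟨
        x * ((1# + 1#) * (1# + 1#) ⁻¹)
          ≈⟨ solve 3 (λ x y i → x :* (con (+ 2) :* i) := (x :+ y) :* i :+ ((x :- y) :* i) :* con (+ 1)) refl x (x ^ q) _ ⟩
        u + ((x - x ^ q) * (1# + 1#) ⁻¹) * 1#                        ≈⟨ +-congˡ (*-congˡ (x⁻¹*x≈1 β≉0)) ⟨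
        u + ((x - x ^ q) * (1# + 1#) ⁻¹) * (β ⁻¹ * β)
          ≈⟨ +-congˡ (solve 4 (λ a i j b → (a :* i) :* (j :* b) := (a :* (i :* j)) :* b) refl (x - x ^ q) _ (β ⁻¹) β) ⟩
        u + v * β                                                    ∎

    vβ∈F⇒v≈0 : ∀ {v} → InF v → InF (v * β) → v ≈ 0#
    vβ∈F⇒v≈0 {v} InF-v InF-vβ with toSum (v ≟ 0#)
    ... | inj₁ v≈0 = v≈0
    ... | inj₂ v≉0 = ⊥-elim (β∉F (InF-resp (sym (y≈x⁻¹*[x*y] β v≉0)) (InF-* (InF-⁻¹ InF-v) InF-vβ)))

    decompose-unique : ∀ {u v u′ v′} → InF u → InF v → InF u′ → InF v′ → u + v * β ≈ u′ + v′ * β →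
                       u ≈ u′ × v ≈ v′
    decompose-unique {u} {v} {u′} {v′} InF-u InF-v InF-u′ InF-v′ u+vβ≈u′+v′β = u≈u′ , v≈v′
      where
      [v-v′]β≈u′-u : (v - v′) * β ≈ u′ - u
      [v-v′]β≈u′-u = begin
        (v - v′) * β
          ≈⟨ solve 4 (λ u v v′ b → (v :- v′) :* b := (u :+ v :* b) :- (u :+ v′ :* b)) refl u v v′ β ⟩
        (u + v * β) - (u + v′ * β)    ≈⟨ +-congʳ u+vβ≈u′+v′β ⟩
        (u′ + v′ * β) - (u + v′ * β)
          ≈⟨ solve 4 (λ u u′ v′ b → (u′ :+ v′ :* b) :- (u :+ v′ :* b) := u′ :- u) refl u u′ v′ β ⟩
        u′ - u                        ∎
      v-v′≈0 : v - v′ ≈ 0#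
      v-v′≈0 = vβ∈F⇒v≈0 (InF-+ InF-v (InF-neg InF-v′)) (InF-resp (sym [v-v′]β≈u′-u) (InF-+ InF-u′ (InF-neg InF-u)))
      v≈v′ : v ≈ v′
      v≈v′ = x-y≈0⇒x≈y v-v′≈0
      u≈u′ : u ≈ u′
      u≈u′ = sym (x-y≈0⇒x≈y (trans (sym [v-v′]β≈u′-u) (trans (*-congʳ v-v′≈0) (zeroˡ β))))

    InF? : Unary.Decidable InF
    InF? x = (x ^ q) ≟ x

    subfield : List Carrier
    subfield = filter InF? elements

    subfield-lists : Listing (U ∩ InF) subfield
    subfield-lists = Listing-filter InF? InF-resp elements-lists

    |subfield|≤q : length subfield ≤ q
    |subfield|≤q = length-roots≤degree 1≉0 (PolyFun-^-lower 1<q PolyFun-id) (Listing.unique subfield-lists)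
      (λ x∈ → trans (+-congʳ (proj₂ (Listing.sound subfield-lists x∈))) (-‿inverseʳ _))
      where
      PolyFun-id : PolyFun 1 1# id
      PolyFun-id = PolyFun-cong 1 refl *-identityʳ (PolyFun-^ 1)

    q*q≤|subfield|² : q ℕ.* q ≤ length subfield ℕ.* length subfield
    q*q≤|subfield|² = ≡.subst₂ _≤_ length-elements (length-cartesianProductWith u+vβ subfield subfield)
      (length-mono-⊆ (Listing.unique elements-lists) elements⊆u+vβ)
      where
      u+vβ : Carrier → Carrier → Carrier
      u+vβ u v = u + v * β
      elements⊆u+vβ : ∀ {x} → x ∈ elements → x ∈ cartesianProductWith u+vβ subfield subfield
      elements⊆u+vβ {x} _ = let _ , _ , InF-u , InF-v , x≈u+vβ = decompose x in
        ∈-resp-≈ setoid (sym x≈u+vβ) (∈-cartesianProductWith⁺ setoid setoid setoid (λ u≈ v≈ → +-cong u≈ (*-congʳ v≈))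
          (Listing.complete subfield-lists (_ , InF-u)) (Listing.complete subfield-lists (_ , InF-v)))

    |subfield|≡q : length subfield ≡ q
    |subfield|≡q with q ℕ.≤? length subfield
    ... | yes q≤|F| = ℕ.≤-antisym |subfield|≤q q≤|F|
    ... | no  q≰|F| = ⊥-elim (ℕ.<⇒≱ (ℕ.*-mono-< (ℕ.≰⇒> q≰|F|) (ℕ.≰⇒> q≰|F|)) q*q≤|subfield|²)

    subfield* : List Carrier
    subfield* = filter (∁? (_≟ 0#)) subfield

    subfield*-lists : Listing ((U ∩ InF) ∩ (_≉ 0#)) subfield*
    subfield*-lists = Listing-filter (∁? (_≟ 0#)) ≉0-resp subfield-lists

    |subfield*|≡q-1 : length subfield* ≡ q ∸ 1
    |subfield*|≡q-1 = ≡.cong (_∸ 1) (≡.trans (1+length-filter≉0 subfield-lists (_ , InF-0)) |subfield|≡q)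

    module F* = FiniteMultiplicativeSubgroup subfield*-lists proj₂ ((_ , InF-1) , 1≉0)
      (λ ((_ , InF-x) , x≉0) ((_ , InF-y) , y≉0) → (_ , InF-* InF-x InF-y) , x≉0∧y≉0⇒x*y≉0 x≉0 y≉0)
      (λ ((_ , InF-x) , x≉0) → (_ , InF-⁻¹ InF-x) , x⁻¹≉0 x≉0)

    InF-β^m : ∀ {m} → 2 ∣ m → InF (β ^ m)
    InF-β^m {m} (divides t ≡.refl) = InF-resp β²ᵗ≈βᵐ (InF-^ t (InF-resp (sym (*-congˡ (*-identityʳ β))) β²∈F))
      where
      β²ᵗ≈βᵐ : (β ^ 2) ^ t ≈ β ^ (t ℕ.* 2)
      β²ᵗ≈βᵐ = trans (^-assocʳ β 2 t) (^-congʳ β (ℕ.*-comm 2 t))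

    module Preimages {a c} (InF-a : InF a) (InF-c : InF c) {m} (2∣m : 2 ∣ m) where

      -- With n = 2 + m the truncated n ∸ 1 and n ∸ 2 of the statement reduce to suc m and m.
      n : ℕ
      n = 2 ℕ.+ m

      δ₁ δ₂ : Carrier
      δ₁ = ((a - c) * (- (1# + 1#)) ^ suc m) * β ^ n
      δ₂ = ((a + c) * (- (1# + 1#)) ^ suc m) * β ^ m

      f : Carrier → Carrier
      f x = (c * x ^ q + a * x) * (x ^ q - x) ^ suc m

      f-cong : ∀ {x y} → x ≈ y → f x ≈ f y
      f-cong x≈y = *-cong (+-cong (*-congˡ (^-congˡ q x≈y)) (*-congˡ x≈y))
                          (^-congˡ (suc m) (+-cong (^-congˡ q x≈y) (-‿cong x≈y)))

      InF-[-2]^ : InF ((- (1# + 1#)) ^ suc m)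
      InF-[-2]^ = InF-^ (suc m) (InF-neg (InF-+ InF-1 InF-1))

      InF-δ₁ : InF δ₁
      InF-δ₁ = InF-* (InF-* (InF-+ InF-a (InF-neg InF-c)) InF-[-2]^) (InF-β^m (∣m∣n⇒∣m+n ∣-refl 2∣m))
      InF-δ₂ : InF δ₂
      InF-δ₂ = InF-* (InF-* (InF-+ InF-a InF-c) InF-[-2]^) (InF-β^m 2∣m)

      f[u+vβ] : ∀ {u v} → InF u → InF v → f (u + v * β) ≈ δ₁ * v ^ n + (δ₂ * (u * v ^ suc m)) * β
      f[u+vβ] {u} {v} InF-u InF-v = begin
        f x
          ≈⟨ *-cong (+-congʳ (*-congˡ xᵠ≈u-vβ)) (^-congˡ (suc m) xᵠ-x≈-2vβ) ⟩
        (c * (u + v * - β) + a * x) * ((- (1# + 1#)) * (v * β)) ^ suc m ≈⟨ *-congˡ [-2vβ]^≈ ⟩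
        (c * (u + v * - β) + a * x) * (T * (v ^ suc m * (β * β ^ m)))
          ≈⟨ solve 8 (λ a c u v b t V B → (c :* (u :+ v :* (:- b)) :+ a :* (u :+ v :* b)) :* (t :* (V :* (b :* B)))
                       := (((a :- c) :* t) :* (b :* (b :* B))) :* (v :* V) :+ ((((a :+ c) :* t) :* B) :* (u :* V)) :* b)
                     refl a c u v β T (v ^ suc m) (β ^ m) ⟩
        δ₁ * v ^ n + (δ₂ * (u * v ^ suc m)) * β                         ∎
        where
        x T : Carrier
        x = u + v * β
        T = (- (1# + 1#)) ^ suc m
        xᵠ≈u-vβ : x ^ q ≈ u + v * - β
        xᵠ≈u-vβ = trans (+-^q u (v * β)) (+-cong InF-u (trans (*-^q v β) (*-cong InF-v β^q≈-β)))
        xᵠ-x≈-2vβ : x ^ q - x ≈ (- (1# + 1#)) * (v * β)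
        xᵠ-x≈-2vβ = trans (+-congʳ xᵠ≈u-vβ)
          (solve 3 (λ u v b → (u :+ v :* (:- b)) :- (u :+ v :* b) := (:- (con (+ 1) :+ con (+ 1))) :* (v :* b)) refl u v β)
        [-2vβ]^≈ : ((- (1# + 1#)) * (v * β)) ^ suc m ≈ T * (v ^ suc m * (β * β ^ m))
        [-2vβ]^≈ = trans (^-distrib-* _ (v * β) (suc m)) (*-congˡ (^-distrib-* v β (suc m)))

      module _ (δ₁δ₂≉0 : δ₁ * δ₂ ≉ 0#) {α α₁ α₂} (InF-α₁ : InF α₁) (InF-α₂ : InF α₂)
               (α≈α₁+α₂β : α ≈ α₁ + α₂ * β) (α≉0 : α ≉ 0#) where

        δ₁≉0 : δ₁ ≉ 0#
        δ₁≉0 δ₁≈0 = δ₁δ₂≉0 (trans (*-congʳ δ₁≈0) (zeroˡ δ₂))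

        δ₂≉0 : δ₂ ≉ 0#
        δ₂≉0 δ₂≈0 = δ₁δ₂≉0 (trans (*-congˡ δ₂≈0) (zeroʳ δ₁))

        γ : Carrier
        γ = δ₁ ⁻¹ * α₁

        coefficient : Carrier → Carrier
        coefficient v = α₂ * (δ₂ * v ^ suc m) ⁻¹

        lift : Carrier → Carrier
        lift v = coefficient v + v * β

        InF-coefficient : ∀ {v} → InF v → InF (coefficient v)
        InF-coefficient InF-v = InF-* InF-α₂ (InF-⁻¹ (InF-* InF-δ₂ (InF-^ (suc m) InF-v)))

        coordinates : ∀ {u v} → InF u → InF v → f (u + v * β) ≈ α →
                      δ₁ * v ^ n ≈ α₁ × δ₂ * (u * v ^ suc m) ≈ α₂
        coordinates InF-u InF-v f[u+vβ]≈α = decompose-unique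
          (InF-* InF-δ₁ (InF-^ n InF-v)) (InF-* InF-δ₂ (InF-* InF-u (InF-^ (suc m) InF-v))) InF-α₁ InF-α₂
          (trans (sym (f[u+vβ] InF-u InF-v)) (trans f[u+vβ]≈α α≈α₁+α₂β))

        δ₂vᵐ⁺¹≉0 : ∀ {v} → v ≉ 0# → δ₂ * v ^ suc m ≉ 0#
        δ₂vᵐ⁺¹≉0 v≉0 = x≉0∧y≉0⇒x*y≉0 δ₂≉0 (x^n≉0 (suc m) v≉0)

        f∘lift≈α : ∀ {v} → InF v → v ≉ 0# → v ^ n ≈ γ → f (lift v) ≈ α
        f∘lift≈α {v} InF-v v≉0 vⁿ≈γ = begin
          f (lift v)                                                ≈⟨ f[u+vβ] (InF-coefficient InF-v) InF-v ⟩
          δ₁ * v ^ n + (δ₂ * (coefficient v * v ^ suc m)) * β       ≈⟨ +-cong (trans (*-congˡ vⁿ≈γ) (x*[x⁻¹*y]≈y α₁ δ₁≉0))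
                                                                               (*-congʳ δ₂[coefficient*vᵐ⁺¹]≈α₂) ⟩
          α₁ + α₂ * β                                               ≈⟨ α≈α₁+α₂β ⟨
          α                                                         ∎
          where
          δ₂[coefficient*vᵐ⁺¹]≈α₂ : δ₂ * (coefficient v * v ^ suc m) ≈ α₂
          δ₂[coefficient*vᵐ⁺¹]≈α₂ = begin
            δ₂ * (α₂ * (δ₂ * v ^ suc m) ⁻¹ * v ^ suc m)
              ≈⟨ solve 4 (λ d a i V → d :* (a :* i :* V) := a :* ((d :* V) :* i)) refl δ₂ α₂ _ (v ^ suc m) ⟩
            α₂ * ((δ₂ * v ^ suc m) * (δ₂ * v ^ suc m) ⁻¹)             ≈⟨ *-congˡ (x*x⁻¹≈1 (δ₂vᵐ⁺¹≉0 v≉0)) ⟩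
            α₂ * 1#                                                   ≈⟨ *-identityʳ α₂ ⟩
            α₂                                                        ∎

        Root : Pred Carrier ℓ
        Root = ((U ∩ InF) ∩ (_≉ 0#)) ∩ (λ v → v ^ n ≈ γ)

        coordinates⇒Root : ∀ {u v} → InF u → InF v → f (u + v * β) ≈ α → Root v × u ≈ coefficient v
        coordinates⇒Root {u} {v} InF-u InF-v f[u+vβ]≈α = (((_ , InF-v) , v≉0) , vⁿ≈γ) , u≈coefficient
          where
          δ₁vⁿ≈α₁ : δ₁ * v ^ n ≈ α₁
          δ₁vⁿ≈α₁ = proj₁ (coordinates InF-u InF-v f[u+vβ]≈α)
          δ₂[u*vᵐ⁺¹]≈α₂ : δ₂ * (u * v ^ suc m) ≈ α₂
          δ₂[u*vᵐ⁺¹]≈α₂ = proj₂ (coordinates InF-u InF-v f[u+vβ]≈α)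
          v≉0 : v ≉ 0#
          v≉0 v≈0 = α≉0 (begin
            α                                          ≈⟨ α≈α₁+α₂β ⟩
            α₁ + α₂ * β                                ≈⟨ +-cong δ₁vⁿ≈α₁ (*-congʳ δ₂[u*vᵐ⁺¹]≈α₂) ⟨
            δ₁ * v ^ n + (δ₂ * (u * v ^ suc m)) * β
              ≈⟨ +-cong (*-congˡ (v^[1+k]≈0 (suc m))) (*-congʳ (*-congˡ (*-congˡ (v^[1+k]≈0 m)))) ⟩
            δ₁ * 0# + (δ₂ * (u * 0#)) * β
              ≈⟨ solve 4 (λ d e u b → d :* con (+ 0) :+ (e :* (u :* con (+ 0))) :* b := con (+ 0)) refl δ₁ δ₂ u β ⟩
            0#                                         ∎)
            where
            v^[1+k]≈0 : ∀ k → v ^ suc k ≈ 0#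
            v^[1+k]≈0 k = trans (^-congˡ (suc k) v≈0) (0^n≈0 {suc k} (s≤s z≤n))
          vⁿ≈γ : v ^ n ≈ γ
          vⁿ≈γ = trans (y≈x⁻¹*[x*y] (v ^ n) δ₁≉0) (*-congˡ δ₁vⁿ≈α₁)
          u≈coefficient : u ≈ coefficient v
          u≈coefficient = trans (y≈x⁻¹*[x*y] u (δ₂vᵐ⁺¹≉0 v≉0))
            (trans (*-congˡ (trans (solve 3 (λ d V u → (d :* V) :* u := d :* (u :* V)) refl δ₂ (v ^ suc m) u) δ₂[u*vᵐ⁺¹]≈α₂))
                   (*-comm _ _))

        preimage⇒lift : ∀ {x} → f x ≈ α → ∃ λ v → Root v × x ≈ lift v
        preimage⇒lift {x} fx≈α =
          let u , v , InF-u , InF-v , x≈u+vβ = decompose x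
              Root-v , u≈coefficient = coordinates⇒Root InF-u InF-v (trans (f-cong (sym x≈u+vβ)) fx≈α)
          in v , Root-v , trans x≈u+vβ (+-congʳ u≈coefficient)

        lift-cong : ∀ {x y} → x ≈ y → lift x ≈ lift y
        lift-cong x≈y = +-cong (*-congˡ (⁻¹-cong (*-congˡ (^-congˡ (suc m) x≈y)))) (*-congʳ x≈y)

        preimages-lists : Listing (λ x → f x ≈ α) (map lift (F*.nthRoots n γ))
        preimages-lists = Listing-map lift-cong
          (λ (((_ , InF-x) , _) , _) (((_ , InF-y) , _) , _) →
             proj₂ ∘ decompose-unique (InF-coefficient InF-x) InF-x (InF-coefficient InF-y) InF-y)
          (λ (((_ , InF-v) , v≉0) , vⁿ≈γ) → f∘lift≈α InF-v v≉0 vⁿ≈γ)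
          preimage⇒lift (λ x≈y fx≈α → trans (f-cong (sym x≈y)) fx≈α) (F*.nthRoots-lists n γ)

        preimageCount-f : preimageCount K _≟_ (q ℕ.* q) (proj₁ enumeration) f α ≡ 0
                        ⊎ preimageCount K _≟_ (q ℕ.* q) (proj₁ enumeration) f α ≡ gcd n (q ∸ 1)
        preimageCount-f = ≡.subst (λ l → l ≡ 0 ⊎ l ≡ gcd n (q ∸ 1)) (≡.sym |preimages|≡|roots|)
          (≡.subst (λ l → length roots ≡ 0 ⊎ length roots ≡ gcd n l) |subfield*|≡q-1 (F*.length-nthRoots n γ))
          where
          roots : List Carrier
          roots = F*.nthRoots n γ
          |preimages|≡|roots| : preimageCount K _≟_ (q ℕ.* q) (proj₁ enumeration) f α ≡ length roots
          |preimages|≡|roots| = ≡.trans (preimageCount≡length f-cong preimages-lists) (List.length-map lift roots)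


mainTheorem4 : ∀ {ℓc ℓ : Level} (q : ℕ) → OddPrimePower q →
  (n : ℕ) → 2 ≤ n → 2 ∣ n →
  (K : CommutativeRing ℓc ℓ) → IsField K →
  (_≟_ : Decidable (CommutativeRing._≈_ K)) →
  (en : Enumeration K (q ℕ.* q)) →
  let open CommutativeRing K
      open RawSemiringDefs (Semiring.rawSemiring semiring) using (_^_)
  in (a c β : Carrier) → InSubfield K q a → InSubfield K q c →
  ¬ InSubfield K q β → InSubfield K q (β * β) →
  let minusTwo = - (1# + 1#)
      δ₁ = ((a + - c) * (minusTwo ^ (n ∸ 1))) * (β ^ n)
      δ₂ = ((a + c) * (minusTwo ^ (n ∸ 1))) * (β ^ (n ∸ 2))
      f : Carrier → Carrier
      f x = ((c * (x ^ q)) + (a * x)) * (((x ^ q) + - x) ^ (n ∸ 1))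
  in ¬ ((δ₁ * δ₂) ≈ 0#) →
  (α : Carrier) → ¬ (α ≈ 0#) →
  (preimageCount K _≟_ (q ℕ.* q) (proj₁ en) f α ≡ 0)
    ⊎ (preimageCount K _≟_ (q ℕ.* q) (proj₁ en) f α ≡ gcd n (q ∸ 1))
mainTheorem4 _ (p , k , p-prime , _ , 1≤k , ≡.refl) (suc (suc m)) (s≤s (s≤s _)) 2∣n
             K isField _≟_ en a c β a∈F c∈F β∉F β²∈F δ₁δ₂≉0 α α≉0
  = let _ , _ , α₁∈F , α₂∈F , α≈α₁+α₂β = decompose α in
    preimageCount-f δ₁δ₂≉0 α₁∈F α₂∈F α≈α₁+α₂β α≉0
  where
  open CommutativeRing K
  open DecidableField K isField _≟_
  open RawSemiringDefs (Semiring.rawSemiring semiring) using (_^_)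
  open import Algebra.Properties.Ring ring using (-0#≈0#)
  2≉0 : 1# + 1# ≉ 0#
  2≉0 2≈0 = δ₁δ₂≉0 (trans (*-congʳ (trans (*-congʳ (trans (*-congˡ [-2]^≈0) (zeroʳ _))) (zeroˡ _))) (zeroˡ _))
    where
    [-2]^≈0 : (- (1# + 1#)) ^ suc m ≈ 0#
    [-2]^≈0 = trans (*-congʳ (trans (-‿cong 2≈0) -0#≈0#)) (zeroˡ _)
  open QuadraticExtension p-prime 1≤k en β∉F β²∈F 2≉0
  open Preimages a∈F c∈F (∣m+n∣m⇒∣n 2∣n ∣-refl)
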